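{- Let $M$ be a connected matroid that has more than one series class. Then $M$ has at least three regular series classes.
   Context: Two non-loop elements $e,f$ of a matroid are parallel if $\{e,f\}$ is a circuit; this is an equivalence relation on non-loop elements and its classes are the parallel classes. A series class of $M$ is a parallel class of the dual matroid $M^\star$. A matroid is connected if it is not the direct sum of two smaller matroids. A series class $S$ of a connected matroid $M$ is regular if the deletion $M-S$ is connected. -}

module Defs where

open import Level using (0ℓ)
open import Data.Nat using (ℕ; _<_)
open import Data.Fin using (Fin)
open import Data.Fin.Subset
  using (Subset; _∈_; _∉_; _⊆_; _⊂_; ⁅_⁆; _∪_; _∩_; ∁; ⊥; ⊤; ∣_∣; Nonempty)
open import Data.Product using (Σ; ∃; _×_; _,_)
open import Data.Sum using (_⊎_)
open import Relation.Nullary using (¬_)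
open import Relation.Unary using (Decidable)
open import Relation.Binary.PropositionalEquality using (_≡_; _≢_)

-- A (finite) matroid on the ground set Fin n, given by its independent sets
-- (independence axioms I1–I3; independence is decidable, which is automatic
-- classically for a finite ground set).
record Matroid (n : ℕ) : Set₁ where
  field
    Indep       : Subset n → Set
    indep?      : Decidable Indep
    indep-empty : Indep ⊥
    indep-sub   : ∀ {I J} → J ⊆ I → Indep I → Indep J
    indep-aug   : ∀ {I J} → Indep I → Indep J → ∣ I ∣ < ∣ J ∣ →
                  ∃ λ e → e ∈ J × e ∉ I × Indep (⁅ e ⁆ ∪ I)

module _ {n : ℕ} (M : Matroid n) where
  open Matroid M

  Base : Subset n → Set
  Base B = Indep B × (∀ I → B ⊆ I → Indep I → I ≡ B)

  CoIndep : Subset n → Set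
  CoIndep I = ∃ λ B → Base B × I ⊆ ∁ B

  Cocircuit : Subset n → Set
  Cocircuit C = ¬ CoIndep C × (∀ D → D ⊂ C → CoIndep D)

  -- non-loop elements of M* (i.e. non-coloops of M)
  CoNonLoop : Fin n → Set
  CoNonLoop e = ¬ Cocircuit ⁅ e ⁆

  CoParallel : Fin n → Fin n → Set
  CoParallel e f = e ≡ f ⊎ Cocircuit (⁅ e ⁆ ∪ ⁅ f ⁆)

  -- S is a series class of M: a parallel class of M*, i.e. the class of
  -- some non-loop e of M*
  SeriesClass : Subset n → Set
  SeriesClass S = ∃ λ e → CoNonLoop e ×
    (∀ f → (f ∈ S → CoNonLoop f × CoParallel e f) ×
           (CoNonLoop f × CoParallel e f → f ∈ S))

  -- The restriction of M to the ground set E (independent sets: the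
  -- independent sets of M contained in E) is the direct sum of its
  -- restrictions to X and E∖X, both nonempty.
  SeparatesOn : Subset n → Subset n → Set
  SeparatesOn E X = X ⊆ E × Nonempty X × Nonempty (E ∩ ∁ X) ×
    (∀ I → I ⊆ E →
      (Indep I → Indep (I ∩ X) × Indep (I ∩ (E ∩ ∁ X))) ×
      (Indep (I ∩ X) × Indep (I ∩ (E ∩ ∁ X)) → Indep I))

  ConnectedOn : Subset n → Set
  ConnectedOn E = ∀ X → ¬ SeparatesOn E X

  Connected : Set
  Connected = ConnectedOn ⊤

  -- the deletion M − S is the restriction of M to ∁ S
  DeletionConnected : Subset n → Set
  DeletionConnected S = ConnectedOn (∁ S)

  RegularSeriesClass : Subset n → Set
  RegularSeriesClass S = SeriesClass S × DeletionConnected S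

-- Pass to the dual matroid M* with rank function r*. Series classes of M are the parallel
-- classes of r*, M is connected iff M* is, and M − S is connected iff the contraction of M* by
-- the class S is. So it suffices to find, in a connected matroid with two parallel classes,
-- three parallel classes each of whose contraction keeps it connected. This is proved for any
-- matroid rank function on a set G by induction on |G|, in the stronger form "for every p there
-- are two such classes, not parallel to p or to each other". Take p, x, y pairwise
-- non-parallel; if all three classes contract well we are done. Otherwise contracting the class
-- of some z splits G into sides A and B, each spanning z. Then G minus B is connected and
-- smaller, the induction hypothesis at z gives two good classes inside A, and they remain good
-- in G; symmetrically for B. One class from each side avoids p, and classes on opposite sides
-- are never parallel.

module Submission where

open import Defs
open import Data.Nat using (ℕ; zero; suc; _+_; _∸_; _≤_; _<_; _≤?_; z≤n; s≤s)
open import Data.Nat.Properties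
open import Data.Nat.Tactic.RingSolver using (solve-∀)
open import Data.Bool using (true)
open import Data.Fin using (Fin)
open import Data.Fin.Properties using (any?) renaming (_≟_ to _≟ᶠ_)
open import Data.Vec using ([]; _∷_; here; tabulate)
open import Data.Vec.Properties using (lookup∘tabulate; lookup⇒[]=; []=⇒lookup)
open import Data.Fin.Subset
open import Data.Fin.Subset.Properties
open import Data.Product using (Σ; ∃; ∃₂; _×_; _,_; proj₁; proj₂)
open import Data.Sum using (_⊎_; inj₁; inj₂; [_,_]′)
open import Data.Empty using (⊥-elim) renaming (⊥ to ⊥₀)
open import Relation.Nullary using (¬_; Dec; yes; no; does; proof)
open import Relation.Nullary.Decidable using (_×-dec_; dec-true; ¬?)
open import Relation.Nullary.Reflects using (Reflects; invert)
open import Relation.Binary.PropositionalEquality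
open import Function using (id; _∘_)
open import Level using (0ℓ)
open import Induction.WellFounded using (module All)
import Relation.Binary.Construct.On as On
open import Data.Nat.Induction using (<-wellFounded)
open import Algebra.Properties.CommutativeSemigroup +-commutativeSemigroup using (interchange)

module SubsetLemmas where

  ∣p∪q∣+∣p∩q∣≡∣p∣+∣q∣ : ∀ {n} (p q : Subset n) → ∣ p ∪ q ∣ + ∣ p ∩ q ∣ ≡ ∣ p ∣ + ∣ q ∣
  ∣p∪q∣+∣p∩q∣≡∣p∣+∣q∣ [] [] = refl
  ∣p∪q∣+∣p∩q∣≡∣p∣+∣q∣ (outside ∷ p) (outside ∷ q) = ∣p∪q∣+∣p∩q∣≡∣p∣+∣q∣ p q
  ∣p∪q∣+∣p∩q∣≡∣p∣+∣q∣ (outside ∷ p) (inside ∷ q) =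
    trans (cong suc (∣p∪q∣+∣p∩q∣≡∣p∣+∣q∣ p q)) (sym (+-suc ∣ p ∣ ∣ q ∣))
  ∣p∪q∣+∣p∩q∣≡∣p∣+∣q∣ (inside ∷ p) (outside ∷ q) = cong suc (∣p∪q∣+∣p∩q∣≡∣p∣+∣q∣ p q)
  ∣p∪q∣+∣p∩q∣≡∣p∣+∣q∣ (inside ∷ p) (inside ∷ q) = cong suc (begin
    ∣ p ∪ q ∣ + suc ∣ p ∩ q ∣ ≡⟨ +-suc ∣ p ∪ q ∣ ∣ p ∩ q ∣ ⟩
    suc (∣ p ∪ q ∣ + ∣ p ∩ q ∣) ≡⟨ cong suc (∣p∪q∣+∣p∩q∣≡∣p∣+∣q∣ p q) ⟩
    suc (∣ p ∣ + ∣ q ∣) ≡⟨ +-suc ∣ p ∣ ∣ q ∣ ⟨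
    ∣ p ∣ + suc ∣ q ∣ ∎)
    where open ≡-Reasoning

  ∣p∪q∣≤∣p∣+∣q∣ : ∀ {n} (p q : Subset n) → ∣ p ∪ q ∣ ≤ ∣ p ∣ + ∣ q ∣
  ∣p∪q∣≤∣p∣+∣q∣ p q = ≤-trans (m≤m+n _ _) (≤-reflexive (∣p∪q∣+∣p∩q∣≡∣p∣+∣q∣ p q))

  Empty⇒∣p∣≡0 : ∀ {n} {p : Subset n} → Empty p → ∣ p ∣ ≡ 0
  Empty⇒∣p∣≡0 {n} e = trans (cong ∣_∣ (Empty-unique e)) (∣⊥∣≡0 n)

  disjoint⇒∣p∪q∣≡∣p∣+∣q∣ : ∀ {n} (p q : Subset n) → (∀ {x} → x ∈ p → x ∉ q) →
                          ∣ p ∪ q ∣ ≡ ∣ p ∣ + ∣ q ∣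
  disjoint⇒∣p∪q∣≡∣p∣+∣q∣ p q disjoint = begin
    ∣ p ∪ q ∣              ≡⟨ +-identityʳ _ ⟨
    ∣ p ∪ q ∣ + 0          ≡⟨ cong (∣ p ∪ q ∣ +_) (Empty⇒∣p∣≡0 p∩q-empty) ⟨
    ∣ p ∪ q ∣ + ∣ p ∩ q ∣  ≡⟨ ∣p∪q∣+∣p∩q∣≡∣p∣+∣q∣ p q ⟩
    ∣ p ∣ + ∣ q ∣          ∎
    where
    open ≡-Reasoning
    p∩q-empty : Empty (p ∩ q)
    p∩q-empty (_ , x∈p∩q) = let x∈p , x∈q = x∈p∩q⁻ p q x∈p∩q in disjoint x∈p x∈q

  p⊆q∧∣q∣≤∣p∣⇒p≡q : ∀ {n} {p q : Subset n} → p ⊆ q → ∣ q ∣ ≤ ∣ p ∣ → p ≡ q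
  p⊆q∧∣q∣≤∣p∣⇒p≡q {p = []} {[]} _ _ = refl
  p⊆q∧∣q∣≤∣p∣⇒p≡q {p = outside ∷ p} {outside ∷ q} p⊆q ∣q∣≤∣p∣ =
    cong (outside ∷_) (p⊆q∧∣q∣≤∣p∣⇒p≡q (drop-∷-⊆ p⊆q) ∣q∣≤∣p∣)
  p⊆q∧∣q∣≤∣p∣⇒p≡q {p = inside ∷ p} {inside ∷ q} p⊆q ∣q∣≤∣p∣ =
    cong (inside ∷_) (p⊆q∧∣q∣≤∣p∣⇒p≡q (drop-∷-⊆ p⊆q) (≤-pred ∣q∣≤∣p∣))
  p⊆q∧∣q∣≤∣p∣⇒p≡q {p = inside ∷ p} {outside ∷ q} p⊆q _ with p⊆q here
  ... | ()
  p⊆q∧∣q∣≤∣p∣⇒p≡q {p = outside ∷ p} {inside ∷ q} p⊆q ∣q∣≤∣p∣ =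
    ⊥-elim (<⇒≱ (s≤s (p⊆q⇒∣p∣≤∣q∣ (drop-∷-⊆ p⊆q))) ∣q∣≤∣p∣)

  ∁⊤-empty : ∀ {n} → Empty (∁ (⊤ {n}))
  ∁⊤-empty (_ , x∈∁⊤) = x∈∁p⇒x∉p x∈∁⊤ ∈⊤

  x∈p⇒⁅x⁆⊆p : ∀ {n} {x : Fin n} {p : Subset n} → x ∈ p → ⁅ x ⁆ ⊆ p
  x∈p⇒⁅x⁆⊆p {x = x} x∈p y∈⁅x⁆ = subst (_∈ _) (sym (x∈⁅y⁆⇒x≡y x y∈⁅x⁆)) x∈p

  x∈p⇒1≤∣p∣ : ∀ {n} {x : Fin n} {p : Subset n} → x ∈ p → 1 ≤ ∣ p ∣
  x∈p⇒1≤∣p∣ {x = x} x∈p = ≤-trans (≤-reflexive (sym (∣⁅x⁆∣≡1 x))) (p⊆q⇒∣p∣≤∣q∣ (x∈p⇒⁅x⁆⊆p x∈p))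

  ∪-monoˡ-⊆ : ∀ {n} {p q r : Subset n} → p ⊆ q → p ∪ r ⊆ q ∪ r
  ∪-monoˡ-⊆ {p = p} {q} {r} p⊆q = [ p⊆p∪q r ∘ p⊆q , q⊆p∪q q r ]′ ∘ x∈p∪q⁻ p r

  ∪-monoʳ-⊆ : ∀ {n} (p : Subset n) {q r : Subset n} → q ⊆ r → p ∪ q ⊆ p ∪ r
  ∪-monoʳ-⊆ p {q} q⊆r = [ p⊆p∪q _ , q⊆p∪q p _ ∘ q⊆r ]′ ∘ x∈p∪q⁻ p q

  ⊆⁅x⁆∪q∧x∉⇒⊆q : ∀ {n} {x : Fin n} {q D : Subset n} → D ⊆ ⁅ x ⁆ ∪ q → x ∉ D → D ⊆ q
  ⊆⁅x⁆∪q∧x∉⇒⊆q {x = x} {q} {D} D⊆ x∉D d∈D with x∈p∪q⁻ ⁅ x ⁆ q (D⊆ d∈D)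
  ... | inj₂ d∈q = d∈q
  ... | inj₁ d∈⁅x⁆ = ⊥-elim (x∉D (subst (_∈ D) (x∈⁅y⁆⇒x≡y x d∈⁅x⁆) d∈D))

  E⊆X∪[E∩∁X] : ∀ {n} (E X : Subset n) → E ⊆ X ∪ (E ∩ ∁ X)
  E⊆X∪[E∩∁X] E X {x} x∈E with x ∈? X
  ... | yes x∈X = p⊆p∪q _ x∈X
  ... | no x∉X = q⊆p∪q X _ (x∈p∩q⁺ (x∈E , x∉p⇒x∈∁p x∉X))

module MatroidRank {n : ℕ} (M : Matroid n) where
  open Matroid M
  open SubsetLemmas

  IsRank : Subset n → ℕ → Set
  IsRank X k = (∃ λ I → I ⊆ X × Indep I × ∣ I ∣ ≡ k) × (∀ J → J ⊆ X → Indep J → ∣ J ∣ ≤ k)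

  abstract
    isRank-below : ∀ X m → (∀ J → J ⊆ X → Indep J → ∣ J ∣ ≤ m) → Σ ℕ (IsRank X)
    isRank-below X m bound
      with anySubset? (λ I → (I ⊆? X) ×-dec (indep? I ×-dec (∣ I ∣ ≟ m)))
    ... | yes attained = m , attained , bound
    isRank-below X zero bound | no ¬attained =
      ⊥-elim (¬attained (⊥ , (λ x∈⊥ → ⊥-elim (∉⊥ x∈⊥)) , indep-empty , ∣⊥∣≡0 n))
    isRank-below X (suc m) bound | no ¬attained = isRank-below X m λ J J⊆X indepJ →
      ≤-pred (≤∧≢⇒< (bound J J⊆X indepJ) λ ∣J∣≡m → ¬attained (J , J⊆X , indepJ , ∣J∣≡m))

    r : Subset n → ℕ
    r X = proj₁ (isRank-below X n (λ J _ _ → ∣p∣≤n J))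

    r-attained : ∀ X → ∃ λ I → I ⊆ X × Indep I × ∣ I ∣ ≡ r X
    r-attained X = proj₁ (proj₂ (isRank-below X n (λ J _ _ → ∣p∣≤n J)))

    r-maximal : ∀ X J → J ⊆ X → Indep J → ∣ J ∣ ≤ r X
    r-maximal X = proj₂ (proj₂ (isRank-below X n (λ J _ _ → ∣p∣≤n J)))

  Indep⇒∣I∣≤r : ∀ {I} → Indep I → ∣ I ∣ ≤ r I
  Indep⇒∣I∣≤r {I} = r-maximal I I ⊆-refl

  ∣I∣≤r⇒Indep : ∀ {I} → ∣ I ∣ ≤ r I → Indep I
  ∣I∣≤r⇒Indep {I} ∣I∣≤r with r-attained I
  ... | K , K⊆I , indepK , ∣K∣≡r =
    subst Indep (p⊆q∧∣q∣≤∣p∣⇒p≡q K⊆I (≤-trans ∣I∣≤r (≤-reflexive (sym ∣K∣≡r)))) indepK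

  r-mono : ∀ {X Y} → X ⊆ Y → r X ≤ r Y
  r-mono {X} {Y} X⊆Y with r-attained X
  ... | K , K⊆X , indepK , ∣K∣≡r = ≤-trans (≤-reflexive (sym ∣K∣≡r)) (r-maximal Y K (X⊆Y ∘ K⊆X) indepK)

  r≤∣X∣ : ∀ X → r X ≤ ∣ X ∣
  r≤∣X∣ X with r-attained X
  ... | K , K⊆X , _ , ∣K∣≡r = ≤-trans (≤-reflexive (sym ∣K∣≡r)) (p⊆q⇒∣p∣≤∣q∣ K⊆X)

  extend-to-rank : ∀ Z I → I ⊆ Z → Indep I → ∃ λ J → I ⊆ J × J ⊆ Z × Indep J × ∣ J ∣ ≡ r Z
  extend-to-rank Z I I⊆Z indepI = extend (r Z ∸ ∣ I ∣) I I⊆Z indepI (m∸n+n≡m (r-maximal Z I I⊆Z indepI))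
    where
    extend : ∀ d I → I ⊆ Z → Indep I → d + ∣ I ∣ ≡ r Z →
             ∃ λ J → I ⊆ J × J ⊆ Z × Indep J × ∣ J ∣ ≡ r Z
    extend zero I I⊆Z indepI d+∣I∣≡r = I , ⊆-refl , I⊆Z , indepI , d+∣I∣≡r
    extend (suc d) I I⊆Z indepI d+∣I∣≡r with r-attained Z
    ... | K , K⊆Z , indepK , ∣K∣≡r
      with indep-aug indepI indepK (≤-trans (s≤s (m≤n+m ∣ I ∣ d)) (≤-reflexive (trans d+∣I∣≡r (sym ∣K∣≡r))))
    ... | e , e∈K , e∉I , indep-eI
      with extend d (⁅ e ⁆ ∪ I) eI⊆Z indep-eI (trans (cong (d +_) ∣eI∣≡1+∣I∣) (trans (+-suc d ∣ I ∣) d+∣I∣≡r))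
      where
      eI⊆Z : ⁅ e ⁆ ∪ I ⊆ Z
      eI⊆Z x∈ = [ (λ x∈⁅e⁆ → x∈p⇒⁅x⁆⊆p (K⊆Z e∈K) x∈⁅e⁆) , I⊆Z ]′ (x∈p∪q⁻ ⁅ e ⁆ I x∈)
      ∣eI∣≡1+∣I∣ : ∣ ⁅ e ⁆ ∪ I ∣ ≡ suc ∣ I ∣
      ∣eI∣≡1+∣I∣ = trans (disjoint⇒∣p∪q∣≡∣p∣+∣q∣ ⁅ e ⁆ I λ x∈⁅e⁆ x∈I → e∉I (subst (_∈ I) (x∈⁅y⁆⇒x≡y e x∈⁅e⁆) x∈I))
                         (cong (_+ ∣ I ∣) (∣⁅x⁆∣≡1 e))
    ... | J , eI⊆J , J⊆Z , indepJ , ∣J∣≡r = J , (λ x∈I → eI⊆J (q⊆p∪q ⁅ e ⁆ I x∈I)) , J⊆Z , indepJ , ∣J∣≡r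

  r-submodular : ∀ X Y → r (X ∪ Y) + r (X ∩ Y) ≤ r X + r Y
  r-submodular X Y with r-attained (X ∩ Y)
  ... | I , I⊆X∩Y , indepI , ∣I∣≡r with extend-to-rank (X ∪ Y) I (λ x∈I → p⊆p∪q Y (p∩q⊆p X Y (I⊆X∩Y x∈I))) indepI
  ... | J , I⊆J , J⊆X∪Y , indepJ , ∣J∣≡r = begin
    r (X ∪ Y) + r (X ∩ Y)                          ≡⟨ cong₂ _+_ (sym ∣J∣≡r) (sym ∣I∣≡r) ⟩
    ∣ J ∣ + ∣ I ∣                                   ≤⟨ +-mono-≤ (p⊆q⇒∣p∣≤∣q∣ J⊆) (p⊆q⇒∣p∣≤∣q∣ I⊆) ⟩
    ∣ (J ∩ X) ∪ (J ∩ Y) ∣ + ∣ (J ∩ X) ∩ (J ∩ Y) ∣  ≡⟨ ∣p∪q∣+∣p∩q∣≡∣p∣+∣q∣ (J ∩ X) (J ∩ Y) ⟩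
    ∣ J ∩ X ∣ + ∣ J ∩ Y ∣                          ≤⟨ +-mono-≤ (r-maximal X (J ∩ X) (p∩q⊆q J X) (indep-sub (p∩q⊆p J X) indepJ))
                                                               (r-maximal Y (J ∩ Y) (p∩q⊆q J Y) (indep-sub (p∩q⊆p J Y) indepJ)) ⟩
    r X + r Y                                      ∎
    where
    open ≤-Reasoning
    J⊆ : J ⊆ (J ∩ X) ∪ (J ∩ Y)
    J⊆ x∈J = [ (λ x∈X → p⊆p∪q _ (x∈p∩q⁺ (x∈J , x∈X))) , (λ x∈Y → q⊆p∪q _ _ (x∈p∩q⁺ (x∈J , x∈Y))) ]′
               (x∈p∪q⁻ X Y (J⊆X∪Y x∈J))
    I⊆ : I ⊆ (J ∩ X) ∩ (J ∩ Y)
    I⊆ x∈I = let x∈X , x∈Y = x∈p∩q⁻ X Y (I⊆X∩Y x∈I) in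
             x∈p∩q⁺ (x∈p∩q⁺ (I⊆J x∈I , x∈X) , x∈p∩q⁺ (I⊆J x∈I , x∈Y))

module SubmodularRank {n : ℕ} (ρ : Subset n → ℕ)
  (ρ-mono : ∀ {X Y} → X ⊆ Y → ρ X ≤ ρ Y)
  (ρ-submodular : ∀ X Y → ρ (X ∪ Y) + ρ (X ∩ Y) ≤ ρ X + ρ Y)
  (ρ≤∣X∣ : ∀ X → ρ X ≤ ∣ X ∣) where
  open SubsetLemmas

  submodular-⊆ : ∀ {W X Y Z} → W ⊆ X → W ⊆ Y → Z ⊆ X ∪ Y → ρ Z + ρ W ≤ ρ X + ρ Y
  submodular-⊆ {X = X} {Y} W⊆X W⊆Y Z⊆X∪Y =
    ≤-trans (+-mono-≤ (ρ-mono Z⊆X∪Y) (ρ-mono λ w∈W → x∈p∩q⁺ (W⊆X w∈W , W⊆Y w∈W))) (ρ-submodular X Y)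

  ρ⁅x⁆≤1 : ∀ x → ρ ⁅ x ⁆ ≤ 1
  ρ⁅x⁆≤1 x = ≤-trans (ρ≤∣X∣ ⁅ x ⁆) (≤-reflexive (∣⁅x⁆∣≡1 x))

  NonLoop : Fin n → Set
  NonLoop x = 1 ≤ ρ ⁅ x ⁆

  -- A loop is parallel to everything, so transitivity needs a non-loop in the middle.
  Parallel : Fin n → Fin n → Set
  Parallel x y = ρ (⁅ x ⁆ ∪ ⁅ y ⁆) ≤ 1

  Parallel? : ∀ x y → Dec (Parallel x y)
  Parallel? x y = ρ (⁅ x ⁆ ∪ ⁅ y ⁆) ≤? 1

  parallel-refl : ∀ x → Parallel x x
  parallel-refl x = ≤-trans (ρ-mono λ x∈ → [ id , id ]′ (x∈p∪q⁻ ⁅ x ⁆ ⁅ x ⁆ x∈)) (ρ⁅x⁆≤1 x)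

  parallel-sym : ∀ {x y} → Parallel x y → Parallel y x
  parallel-sym {x} {y} = ≤-trans (ρ-mono λ z∈ → [ q⊆p∪q ⁅ x ⁆ ⁅ y ⁆ , p⊆p∪q ⁅ y ⁆ ]′ (x∈p∪q⁻ ⁅ y ⁆ ⁅ x ⁆ z∈))

  parallel-trans : ∀ {x y z} → NonLoop y → Parallel x y → Parallel y z → Parallel x z
  parallel-trans {x} {y} {z} nonLoop-y x∥y y∥z = +-cancelʳ-≤ _ _ _ (begin
    ρ (⁅ x ⁆ ∪ ⁅ z ⁆) + ρ ⁅ y ⁆                 ≤⟨ submodular-⊆ (q⊆p∪q ⁅ x ⁆ ⁅ y ⁆) (p⊆p∪q ⁅ z ⁆) xz⊆ ⟩
    ρ (⁅ x ⁆ ∪ ⁅ y ⁆) + ρ (⁅ y ⁆ ∪ ⁅ z ⁆)     ≤⟨ +-mono-≤ x∥y (≤-trans y∥z nonLoop-y) ⟩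
    1 + ρ ⁅ y ⁆                               ∎)
    where
    open ≤-Reasoning
    xz⊆ : ⁅ x ⁆ ∪ ⁅ z ⁆ ⊆ (⁅ x ⁆ ∪ ⁅ y ⁆) ∪ (⁅ y ⁆ ∪ ⁅ z ⁆)
    xz⊆ w∈ = [ p⊆p∪q _ ∘ p⊆p∪q ⁅ y ⁆ , q⊆p∪q _ _ ∘ q⊆p∪q ⁅ y ⁆ ⁅ z ⁆ ]′ (x∈p∪q⁻ ⁅ x ⁆ ⁅ z ⁆ w∈)

  parallelClass : Fin n → Subset n
  parallelClass q = tabulate (λ x → does (Parallel? q x))

  ∈parallelClass⁺ : ∀ {q x} → Parallel q x → x ∈ parallelClass q
  ∈parallelClass⁺ {q} {x} q∥x =
    lookup⇒[]= x (parallelClass q) (trans (lookup∘tabulate _ x) (dec-true (Parallel? q x) q∥x))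

  ∈parallelClass⁻ : ∀ {q x} → x ∈ parallelClass q → Parallel q x
  ∈parallelClass⁻ {q} {x} x∈ = invert (subst (Reflects (Parallel q x)) does≡true (proof (Parallel? q x)))
    where
    does≡true : does (Parallel? q x) ≡ true
    does≡true = trans (sym (lookup∘tabulate (λ y → does (Parallel? q y)) x)) ([]=⇒lookup x∈)

  q∈parallelClass : ∀ q → q ∈ parallelClass q
  q∈parallelClass q = ∈parallelClass⁺ (parallel-refl q)

  ⊆∪parallelClass : ∀ {z X Y} → (∀ {w} → w ∈ X → ¬ Parallel z w → w ∈ Y) → X ⊆ Y ∪ parallelClass z
  ⊆∪parallelClass {z} {Y = Y} off-class {w} w∈X with Parallel? z w
  ... | yes z∥w = q⊆p∪q Y _ (∈parallelClass⁺ z∥w)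
  ... | no z∦w = p⊆p∪q _ (off-class w∈X z∦w)

  parallel-spanned : ∀ {z y Y} → z ∈ Y → NonLoop z → Parallel z y → ρ (Y ∪ ⁅ y ⁆) ≤ ρ Y
  parallel-spanned {z} {y} {Y} z∈Y nonLoop-z z∥y = +-cancelʳ-≤ _ _ _ (begin
    ρ (Y ∪ ⁅ y ⁆) + ρ ⁅ z ⁆         ≤⟨ submodular-⊆ (x∈p⇒⁅x⁆⊆p z∈Y) (p⊆p∪q ⁅ y ⁆) Yy⊆ ⟩
    ρ Y + ρ (⁅ z ⁆ ∪ ⁅ y ⁆)         ≤⟨ +-monoʳ-≤ (ρ Y) (≤-trans z∥y nonLoop-z) ⟩
    ρ Y + ρ ⁅ z ⁆                   ∎)
    where
    open ≤-Reasoning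
    Yy⊆ : Y ∪ ⁅ y ⁆ ⊆ Y ∪ (⁅ z ⁆ ∪ ⁅ y ⁆)
    Yy⊆ w∈ = [ p⊆p∪q _ , q⊆p∪q Y _ ∘ q⊆p∪q ⁅ z ⁆ ⁅ y ⁆ ]′ (x∈p∪q⁻ Y ⁅ y ⁆ w∈)

  spanned-∪ : ∀ Y S → (∀ {y} → y ∈ S → ρ (Y ∪ ⁅ y ⁆) ≤ ρ Y) → ρ (Y ∪ S) ≤ ρ Y
  spanned-∪ Y S = by-size ∣ S ∣ S ≤-refl
    where
    by-size : ∀ k S → ∣ S ∣ ≤ k → (∀ {y} → y ∈ S → ρ (Y ∪ ⁅ y ⁆) ≤ ρ Y) → ρ (Y ∪ S) ≤ ρ Y
    by-size k S ∣S∣≤k spans with nonempty? S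
    ... | no empty = ρ-mono λ w∈ → [ id , (λ w∈S → ⊥-elim (empty (_ , w∈S))) ]′ (x∈p∪q⁻ Y S w∈)
    by-size zero S ∣S∣≤0 spans | yes (x , x∈S) = ⊥-elim (<⇒≱ (≤-trans (x∈p⇒1≤∣p∣ x∈S) ∣S∣≤0) z≤n)
    by-size (suc k) S ∣S∣≤k spans | yes (x , x∈S) = +-cancelʳ-≤ _ _ _ (begin
      ρ (Y ∪ S) + ρ Y                 ≤⟨ submodular-⊆ (p⊆p∪q _) (p⊆p∪q _) YS⊆ ⟩
      ρ (Y ∪ (S - x)) + ρ (Y ∪ ⁅ x ⁆) ≤⟨ +-mono-≤ (by-size k (S - x) ∣S-x∣≤k (spans ∘ p─q⊆p S ⁅ x ⁆)) (spans x∈S) ⟩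
      ρ Y + ρ Y                       ∎)
      where
      open ≤-Reasoning
      ∣S-x∣≤k : ∣ S - x ∣ ≤ k
      ∣S-x∣≤k = ≤-pred (≤-trans (x∈p⇒∣p-x∣<∣p∣ x∈S) ∣S∣≤k)
      YS⊆ : Y ∪ S ⊆ (Y ∪ (S - x)) ∪ (Y ∪ ⁅ x ⁆)
      YS⊆ {w} w∈ with x∈p∪q⁻ Y S w∈ | w ≟ᶠ x
      ... | inj₁ w∈Y | _ = p⊆p∪q _ (p⊆p∪q _ w∈Y)
      ... | inj₂ _ | yes refl = q⊆p∪q _ _ (q⊆p∪q Y _ (x∈⁅x⁆ w))
      ... | inj₂ w∈S | no w≢x = p⊆p∪q _ (q⊆p∪q Y _ (x∈p∧x≢y⇒x∈p-y w∈S w≢x))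

  class-spanned : ∀ {z Y Z} → z ∈ Y → NonLoop z → Z ⊆ Y ∪ parallelClass z → ρ Z ≤ ρ Y
  class-spanned {z} {Y} z∈Y nonLoop-z Z⊆ = ≤-trans (ρ-mono Z⊆)
    (spanned-∪ Y (parallelClass z) (parallel-spanned z∈Y nonLoop-z ∘ ∈parallelClass⁻))

  ρ≤1-inside-class : ∀ {x Z} → NonLoop x → Z ⊆ parallelClass x → ρ Z ≤ 1
  ρ≤1-inside-class {x} nonLoop-x Z⊆ = ≤-trans (class-spanned (x∈⁅x⁆ x) nonLoop-x (q⊆p∪q _ _ ∘ Z⊆)) (ρ⁅x⁆≤1 x)

  RankConnected : Subset n → Set
  RankConnected G = ∀ A → A ⊆ G → Nonempty A → Nonempty (G ∩ ∁ A) → suc (ρ G) ≤ ρ A + ρ (G ∩ ∁ A)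

  connected-split : ∀ {G A B x y} → RankConnected G → A ⊆ G → x ∈ A → y ∈ G → y ∉ A →
                    (∀ {w} → w ∈ G → w ∉ A → w ∈ B) → suc (ρ G) ≤ ρ A + ρ B
  connected-split {G} {A} conn A⊆G x∈A y∈G y∉A rest⊆B =
    ≤-trans (conn A A⊆G (_ , x∈A) (_ , x∈p∩q⁺ (y∈G , x∉p⇒x∈∁p y∉A)))
      (+-monoʳ-≤ (ρ A) (ρ-mono λ w∈ → let w∈G , w∈∁A = x∈p∩q⁻ G (∁ A) w∈ in rest⊆B w∈G (x∈∁p⇒x∉p w∈∁A)))

  ρ≥2⇒∃other : ∀ {G x} → 2 ≤ ρ G → x ∈ G → ∃ λ y → y ∈ G × y ≢ x
  ρ≥2⇒∃other {G} {x} 2≤ρG x∈G with any? (λ y → (y ∈? G) ×-dec ¬? (y ≟ᶠ x))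
  ... | yes found = found
  ... | no none = ⊥-elim (<⇒≱ 2≤ρG (≤-trans (ρ-mono G⊆⁅x⁆) (ρ⁅x⁆≤1 x)))
    where
    G⊆⁅x⁆ : G ⊆ ⁅ x ⁆
    G⊆⁅x⁆ {y} y∈G with y ≟ᶠ x
    ... | yes refl = x∈⁅x⁆ y
    ... | no y≢x = ⊥-elim (none (y , y∈G , y≢x))

  connected⇒nonLoop : ∀ {G x} → RankConnected G → 2 ≤ ρ G → x ∈ G → NonLoop x
  connected⇒nonLoop {G} {x} conn 2≤ρG x∈G with ρ≥2⇒∃other 2≤ρG x∈G
  ... | y , y∈G , y≢x = +-cancelʳ-≤ (ρ G) 1 (ρ ⁅ x ⁆)
    (connected-split conn (x∈p⇒⁅x⁆⊆p x∈G) (x∈⁅x⁆ x) y∈G (y≢x ∘ x∈⁅y⁆⇒x≡y x) (λ w∈G _ → w∈G))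

  ∃nonParallel : ∀ {G x} → RankConnected G → 2 ≤ ρ G → x ∈ G → ∃ λ y → y ∈ G × ¬ Parallel x y
  ∃nonParallel {G} {x} conn 2≤ρG x∈G with any? (λ y → (y ∈? G) ×-dec ¬? (Parallel? x y))
  ... | yes found = found
  ... | no none = ⊥-elim (<⇒≱ 2≤ρG (ρ≤1-inside-class (connected⇒nonLoop conn 2≤ρG x∈G) G⊆class))
    where
    G⊆class : G ⊆ parallelClass x
    G⊆class {y} y∈G with Parallel? x y
    ... | yes x∥y = ∈parallelClass⁺ x∥y
    ... | no x∦y = ⊥-elim (none (y , y∈G , x∦y))

  ∃nonParallelToBoth : ∀ {G x y} → RankConnected G → 2 ≤ ρ G → x ∈ G → y ∈ G → ¬ Parallel x y →
                       ∃ λ z → z ∈ G × ¬ Parallel x z × ¬ Parallel y z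
  ∃nonParallelToBoth {G} {x} {y} conn 2≤ρG x∈G y∈G x∦y
    with any? (λ z → (z ∈? G) ×-dec (¬? (Parallel? x z) ×-dec ¬? (Parallel? y z)))
  ... | yes found = found
  ... | no none = ⊥-elim (<⇒≱ 2≤ρG (≤-pred (≤-trans
        (connected-split conn (p∩q⊆p G _) (x∈p∩q⁺ (x∈G , q∈parallelClass x)) y∈G
          (x∦y ∘ ∈parallelClass⁻ ∘ p∩q⊆q G _) rest⊆)
        (+-mono-≤ (ρ≤1-inside-class (connected⇒nonLoop conn 2≤ρG x∈G) (p∩q⊆q G _))
                  (ρ≤1-inside-class (connected⇒nonLoop conn 2≤ρG y∈G) (p∩q⊆q G _))))))
    where
    rest⊆ : ∀ {w} → w ∈ G → w ∉ G ∩ parallelClass x → w ∈ G ∩ parallelClass y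
    rest⊆ {w} w∈G w∉ with Parallel? y w
    ... | yes y∥w = x∈p∩q⁺ (w∈G , ∈parallelClass⁺ y∥w)
    ... | no y∦w = ⊥-elim (none (w , w∈G , (λ x∥w → w∉ (x∈p∩q⁺ (w∈G , ∈parallelClass⁺ x∥w))) , y∦w))

  offClass : Subset n → Fin n → Subset n
  offClass G q = G ∩ ∁ (parallelClass q)

  q∉offClass : ∀ {G q} → q ∉ offClass G q
  q∉offClass {G} {q} q∈ = x∈∁p⇒x∉p (p∩q⊆q G _ q∈) (q∈parallelClass q)

  ∈offClass⁺ : ∀ {G q x} → x ∈ G → ¬ Parallel q x → x ∈ offClass G q
  ∈offClass⁺ x∈G q∦x = x∈p∩q⁺ (x∈G , x∉p⇒x∈∁p (q∦x ∘ ∈parallelClass⁻))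

  offClass⊆ : ∀ {G q} → offClass G q ⊆ G
  offClass⊆ {G} = p∩q⊆p G _

  ∈offClass⇒∦ : ∀ {G q x} → x ∈ offClass G q → ¬ Parallel q x
  ∈offClass⇒∦ {G} x∈ q∥x = x∈∁p⇒x∉p (p∩q⊆q G _ x∈) (∈parallelClass⁺ q∥x)

  -- Since ρ ⁅ q ⁆ = 1, this says that contracting the class of q leaves G connected.
  ContractionConnected : Subset n → Fin n → Set
  ContractionConnected G q = ∀ U → U ⊆ offClass G q → Nonempty U → Nonempty (offClass G q ∩ ∁ U) →
    suc (suc (ρ G)) ≤ ρ (⁅ q ⁆ ∪ U) + ρ (⁅ q ⁆ ∪ (offClass G q ∩ ∁ U))

  BadSplit : Subset n → Fin n → Subset n → Set
  BadSplit G q U = U ⊆ offClass G q × Nonempty U × Nonempty (offClass G q ∩ ∁ U) ×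
    (ρ (⁅ q ⁆ ∪ U) + ρ (⁅ q ⁆ ∪ (offClass G q ∩ ∁ U)) ≤ suc (ρ G))

  badSplit⊎contractionConnected : ∀ G q → ∃ (BadSplit G q) ⊎ ContractionConnected G q
  badSplit⊎contractionConnected G q
    with anySubset? {P = BadSplit G q} (λ U → (U ⊆? _) ×-dec (nonempty? U ×-dec (nonempty? _ ×-dec (_ ≤? _))))
  ... | yes bad = inj₁ bad
  ... | no none = inj₂ λ U U⊆ U≠∅ V≠∅ → ≮⇒≥ λ small → none (U , U⊆ , U≠∅ , V≠∅ , ≤-pred small)

  ContractibleAvoiding : Subset n → Fin n → Subset n → Set
  ContractibleAvoiding G p S = ∃ λ q → q ∈ S × ContractionConnected G q × ¬ Parallel p q

  ContractiblePairIn : Subset n → Subset n → Set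
  ContractiblePairIn G S = ∃₂ λ q r → q ∈ S × r ∈ S × ContractionConnected G q × ContractionConnected G r × ¬ Parallel q r

  ContractiblePairAvoiding : Subset n → Fin n → Set
  ContractiblePairAvoiding G p = ∃₂ λ q r → q ∈ G × r ∈ G × ContractionConnected G q × ContractionConnected G r ×
    ¬ Parallel p q × ¬ Parallel p r × ¬ Parallel q r

  -- A and B split the contraction of G by the class of z, and z lies in the closure of each side.
  record Separation (G : Subset n) (z : Fin n) (A B : Subset n) : Set where
    field
      A⊆      : A ⊆ offClass G z
      B⊆      : B ⊆ offClass G z
      disjoint : ∀ {x} → x ∈ A → x ∉ B
      cover   : ∀ {x} → x ∈ offClass G z → x ∈ A ⊎ x ∈ B
      A≠∅     : Nonempty A
      B≠∅     : Nonempty B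
      A-spans : ρ (⁅ z ⁆ ∪ A) ≤ ρ A
      B-spans : ρ (⁅ z ⁆ ∪ B) ≤ ρ B
      tight   : ρ A + ρ B ≤ suc (ρ G)

  separation-swap : ∀ {G z A B} → Separation G z A B → Separation G z B A
  separation-swap {A = A} {B} s = record
    { A⊆ = B⊆ ; B⊆ = A⊆ ; disjoint = λ x∈B x∈A → disjoint x∈A x∈B
    ; cover = [ inj₂ , inj₁ ]′ ∘ cover
    ; A≠∅ = B≠∅ ; B≠∅ = A≠∅ ; A-spans = B-spans ; B-spans = A-spans
    ; tight = ≤-trans (≤-reflexive (+-comm (ρ B) (ρ A))) tight }
    where open Separation s

  connected-contraction-split : ∀ {G z U V x} → RankConnected G → z ∈ G → NonLoop z →
    U ⊆ offClass G z → x ∈ U → (∀ {w} → w ∈ offClass G z → w ∉ U → w ∈ V) →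
    suc (ρ G) ≤ ρ U + ρ (⁅ z ⁆ ∪ V)
  connected-contraction-split {G} {z} {U} {V} conn z∈G nonLoop-z U⊆ x∈U rest⊆V = ≤-trans
    (connected-split conn (offClass⊆ ∘ U⊆) x∈U z∈G (q∉offClass ∘ U⊆) rest⊆)
    (+-monoʳ-≤ (ρ U) (class-spanned (p⊆p∪q V (x∈⁅x⁆ z)) nonLoop-z id))
    where
    rest⊆ : ∀ {w} → w ∈ G → w ∉ U → w ∈ (⁅ z ⁆ ∪ V) ∪ parallelClass z
    rest⊆ {w} w∈G w∉U with Parallel? z w
    ... | yes z∥w = q⊆p∪q _ _ (∈parallelClass⁺ z∥w)
    ... | no z∦w = p⊆p∪q _ (q⊆p∪q ⁅ z ⁆ V (rest⊆V (∈offClass⁺ w∈G z∦w) w∉U))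

  badSplit⇒separation : ∀ {G z U} → RankConnected G → z ∈ G → NonLoop z → BadSplit G z U →
                        Separation G z U (offClass G z ∩ ∁ U)
  badSplit⇒separation {G} {z} {U} conn z∈G nonLoop-z (U⊆ , U≠∅ , V≠∅ , bad) = record
    { A⊆ = U⊆ ; B⊆ = p∩q⊆p _ _
    ; disjoint = λ x∈U x∈V → x∈∁p⇒x∉p (p∩q⊆q _ _ x∈V) x∈U
    ; cover = cover
    ; A≠∅ = U≠∅ ; B≠∅ = V≠∅
    ; A-spans = +-cancelʳ-≤ _ _ _ (≤-trans bad
        (connected-contraction-split conn z∈G nonLoop-z U⊆ (proj₂ U≠∅) inV))
    ; B-spans = +-cancelʳ-≤ _ _ _ (≤-trans (≤-trans (≤-reflexive (+-comm (ρ (⁅ z ⁆ ∪ V)) (ρ (⁅ z ⁆ ∪ U)))) bad)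
        (connected-contraction-split conn z∈G nonLoop-z (p∩q⊆p _ _) (proj₂ V≠∅) inU))
    ; tight = ≤-trans (+-mono-≤ (ρ-mono (q⊆p∪q ⁅ z ⁆ U)) (ρ-mono (q⊆p∪q ⁅ z ⁆ V))) bad }
    where
    V : Subset n
    V = offClass G z ∩ ∁ U
    inV : ∀ {w} → w ∈ offClass G z → w ∉ U → w ∈ V
    inV w∈ w∉U = x∈p∩q⁺ (w∈ , x∉p⇒x∈∁p w∉U)
    cover : ∀ {x} → x ∈ offClass G z → x ∈ U ⊎ x ∈ V
    cover {x} x∈ with x ∈? U
    ... | yes x∈U = inj₁ x∈U
    ... | no x∉U = inj₂ (inV x∈ x∉U)
    inU : ∀ {w} → w ∈ offClass G z → w ∉ V → w ∈ U
    inU w∈ w∉V = [ id , ⊥-elim ∘ w∉V ]′ (cover w∈)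

  module SeparationFacts {G z A B} (conn : RankConnected G) (z∈G : z ∈ G) (nonLoop-z : NonLoop z)
                         (sep : Separation G z A B) where
    open Separation sep

    G₁ : Subset n
    G₁ = G ∩ ∁ B

    A⊆G : A ⊆ G
    A⊆G = offClass⊆ ∘ A⊆

    B⊆G : B ⊆ G
    B⊆G = offClass⊆ ∘ B⊆

    G₁⊆G : G₁ ⊆ G
    G₁⊆G = p∩q⊆p G _

    ∈G₁⇒∉B : ∀ {x} → x ∈ G₁ → x ∉ B
    ∈G₁⇒∉B = x∈∁p⇒x∉p ∘ p∩q⊆q G _

    A⊆G₁ : A ⊆ G₁
    A⊆G₁ x∈A = x∈p∩q⁺ (A⊆G x∈A , x∉p⇒x∈∁p (disjoint x∈A))

    z∈G₁ : z ∈ G₁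
    z∈G₁ = x∈p∩q⁺ (z∈G , x∉p⇒x∈∁p (q∉offClass ∘ B⊆))

    ∈G₁-off-z⇒∈A : ∀ {x} → x ∈ G₁ → ¬ Parallel z x → x ∈ A
    ∈G₁-off-z⇒∈A x∈G₁ z∦x with cover (∈offClass⁺ (G₁⊆G x∈G₁) z∦x)
    ... | inj₁ x∈A = x∈A
    ... | inj₂ x∈B = ⊥-elim (∈G₁⇒∉B x∈G₁ x∈B)

    ∣G₁∣<∣G∣ : ∣ G₁ ∣ < ∣ G ∣
    ∣G₁∣<∣G∣ = p⊂q⇒∣p∣<∣q∣ (G₁⊆G , _ , B⊆G (proj₂ B≠∅) , λ b∈G₁ → ∈G₁⇒∉B b∈G₁ (proj₂ B≠∅))

    ρG₁≤ρA : ρ G₁ ≤ ρ A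
    ρG₁≤ρA = ≤-trans (class-spanned (p⊆p∪q A (x∈⁅x⁆ z)) nonLoop-z
                        (⊆∪parallelClass (λ x∈G₁ z∦x → q⊆p∪q ⁅ z ⁆ A (∈G₁-off-z⇒∈A x∈G₁ z∦x))))
                     A-spans

    2≤ρG₁ : 2 ≤ ρ G₁
    2≤ρG₁ = ≤-trans 2≤ρA (ρ-mono A⊆G₁)
      where
      2≤ρA : 2 ≤ ρ A
      2≤ρA = ≮⇒≥ λ ρA<2 → ∈offClass⇒∦ (A⊆ (proj₂ A≠∅))
        (≤-trans (ρ-mono (∪-monoʳ-⊆ ⁅ z ⁆ (x∈p⇒⁅x⁆⊆p (proj₂ A≠∅)))) (≤-trans A-spans (≤-pred ρA<2)))

    nonLoop : ∀ {x} → x ∈ G → NonLoop x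
    nonLoop = connected⇒nonLoop conn (≤-trans 2≤ρG₁ (ρ-mono G₁⊆G))

    split-with-z : ∀ {C D x d} → C ⊆ G₁ → D ⊆ G₁ → z ∈ C → x ∈ C → d ∈ D → (∀ {w} → w ∈ D → w ∉ C) →
                   (∀ {w} → w ∈ G₁ → w ∉ D → w ∈ C) → suc (ρ A) ≤ ρ C + ρ D
    split-with-z {C} {D} {x} C⊆ D⊆ z∈C x∈C d∈D D∩C≡∅ rest⊆C = +-cancelʳ-≤ (ρ B) _ _ (begin
      suc (ρ A) + ρ B              ≤⟨ s≤s tight ⟩
      suc (suc (ρ G))              ≡⟨ +-comm 1 (suc (ρ G)) ⟩
      suc (ρ G) + 1                ≤⟨ +-mono-≤ G-split nonLoop-z ⟩
      ρ D + ρ (C ∪ B) + ρ ⁅ z ⁆    ≡⟨ +-assoc (ρ D) _ _ ⟩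
      ρ D + (ρ (C ∪ B) + ρ ⁅ z ⁆)  ≤⟨ +-monoʳ-≤ (ρ D) CB-submodular ⟩
      ρ D + (ρ C + ρ B)            ≡⟨ +-assoc (ρ D) (ρ C) (ρ B) ⟨
      ρ D + ρ C + ρ B              ≡⟨ cong (_+ ρ B) (+-comm (ρ D) (ρ C)) ⟩
      ρ C + ρ D + ρ B              ∎)
      where
      open ≤-Reasoning
      rest⊆C∪B : ∀ {w} → w ∈ G → w ∉ D → w ∈ C ∪ B
      rest⊆C∪B {w} w∈G w∉D with w ∈? B
      ... | yes w∈B = q⊆p∪q C B w∈B
      ... | no w∉B = p⊆p∪q B (rest⊆C (x∈p∩q⁺ (w∈G , x∉p⇒x∈∁p w∉B)) w∉D)
      G-split : suc (ρ G) ≤ ρ D + ρ (C ∪ B)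
      G-split = connected-split conn (G₁⊆G ∘ D⊆) d∈D (G₁⊆G (C⊆ x∈C)) (λ x∈D → D∩C≡∅ x∈D x∈C) rest⊆C∪B
      CB-submodular : ρ (C ∪ B) + ρ ⁅ z ⁆ ≤ ρ C + ρ B
      CB-submodular = ≤-trans (submodular-⊆ (x∈p⇒⁅x⁆⊆p z∈C) (p⊆p∪q B) (∪-monoʳ-⊆ C (q⊆p∪q ⁅ z ⁆ B)))
                              (+-monoʳ-≤ (ρ C) B-spans)

    connected-G₁ : RankConnected G₁
    connected-G₁ C C⊆ (c , c∈C) (d , d∈D) with z ∈? C
    ... | yes z∈C = ≤-trans (s≤s ρG₁≤ρA)
      (split-with-z C⊆ (p∩q⊆p G₁ _) z∈C c∈C d∈D (x∈∁p⇒x∉p ∘ p∩q⊆q G₁ _) rest⊆C)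
      where
      rest⊆C : ∀ {w} → w ∈ G₁ → w ∉ G₁ ∩ ∁ C → w ∈ C
      rest⊆C {w} w∈G₁ w∉D with w ∈? C
      ... | yes w∈C = w∈C
      ... | no w∉C = ⊥-elim (w∉D (x∈p∩q⁺ (w∈G₁ , x∉p⇒x∈∁p w∉C)))
    ... | no z∉C = ≤-trans (s≤s ρG₁≤ρA) (≤-trans
      (split-with-z (p∩q⊆p G₁ _) C⊆ (x∈p∩q⁺ (z∈G₁ , x∉p⇒x∈∁p z∉C)) d∈D c∈C
        (λ c∈C c∈D → x∈∁p⇒x∉p (p∩q⊆q G₁ _ c∈D) c∈C) (λ w∈G₁ w∉C → x∈p∩q⁺ (w∈G₁ , x∉p⇒x∈∁p w∉C)))
      (≤-reflexive (+-comm (ρ (G₁ ∩ ∁ C)) (ρ C))))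

    B-spans-q⇒z∥q : ∀ {q} → q ∈ A → ρ (B ∪ ⁅ q ⁆) ≤ ρ B → Parallel z q
    B-spans-q⇒z∥q {q} q∈A B-spans-q = +-cancelˡ-≤ (ρ G) _ _ (begin
      ρ G + ρ (⁅ z ⁆ ∪ ⁅ q ⁆)      ≤⟨ +-monoˡ-≤ _ ρG≤ρ[X∪Y] ⟩
      ρ (X ∪ Y) + ρ (⁅ z ⁆ ∪ ⁅ q ⁆) ≤⟨ submodular-⊆ zq⊆X zq⊆Y ⊆-refl ⟩
      ρ X + ρ Y                    ≤⟨ +-mono-≤ A-spans ρY≤ρB ⟩
      ρ A + ρ B                    ≤⟨ tight ⟩
      suc (ρ G)                    ≡⟨ +-comm 1 (ρ G) ⟩
      ρ G + 1                      ∎)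
      where
      open ≤-Reasoning
      X Y : Subset n
      X = ⁅ z ⁆ ∪ A
      Y = B ∪ (⁅ q ⁆ ∪ ⁅ z ⁆)
      zq⊆X : ⁅ z ⁆ ∪ ⁅ q ⁆ ⊆ X
      zq⊆X = ∪-monoʳ-⊆ ⁅ z ⁆ (x∈p⇒⁅x⁆⊆p q∈A)
      zq⊆Y : ⁅ z ⁆ ∪ ⁅ q ⁆ ⊆ Y
      zq⊆Y = q⊆p∪q B _ ∘ [ q⊆p∪q ⁅ q ⁆ ⁅ z ⁆ , p⊆p∪q ⁅ z ⁆ ]′ ∘ x∈p∪q⁻ ⁅ z ⁆ ⁅ q ⁆
      ρY≤ρB : ρ Y ≤ ρ B
      ρY≤ρB = spanned-∪ B (⁅ q ⁆ ∪ ⁅ z ⁆) λ {y} y∈ → [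
        (λ y∈⁅q⁆ → subst (λ y → ρ (B ∪ ⁅ y ⁆) ≤ ρ B) (sym (x∈⁅y⁆⇒x≡y q y∈⁅q⁆)) B-spans-q) ,
        (λ y∈⁅z⁆ → subst (λ y → ρ (B ∪ ⁅ y ⁆) ≤ ρ B) (sym (x∈⁅y⁆⇒x≡y z y∈⁅z⁆))
                     (≤-trans (ρ-mono (λ w∈ → [ q⊆p∪q ⁅ z ⁆ B , p⊆p∪q B ]′ (x∈p∪q⁻ B ⁅ z ⁆ w∈))) B-spans)) ]′
        (x∈p∪q⁻ ⁅ q ⁆ ⁅ z ⁆ y∈)
      ρG≤ρ[X∪Y] : ρ G ≤ ρ (X ∪ Y)
      ρG≤ρ[X∪Y] = class-spanned (p⊆p∪q Y (p⊆p∪q A (x∈⁅x⁆ z))) nonLoop-z (⊆∪parallelClass λ w∈G z∦w →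
        [ p⊆p∪q Y ∘ q⊆p∪q ⁅ z ⁆ A , q⊆p∪q X Y ∘ p⊆p∪q _ ]′ (cover (∈offClass⁺ w∈G z∦w)))

    q-not-spanned-in-B : ∀ {q T} → q ∈ A → T ⊆ B → ¬ ρ (⁅ q ⁆ ∪ T) ≤ ρ T
    q-not-spanned-in-B {q} {T} q∈A T⊆B T-spans-q = ∈offClass⇒∦ (A⊆ q∈A) (B-spans-q⇒z∥q q∈A
      (+-cancelʳ-≤ _ _ _ (begin
        ρ (B ∪ ⁅ q ⁆) + ρ T   ≤⟨ submodular-⊆ T⊆B (q⊆p∪q ⁅ q ⁆ T) (∪-monoʳ-⊆ B (p⊆p∪q T)) ⟩
        ρ B + ρ (⁅ q ⁆ ∪ T)   ≤⟨ +-monoʳ-≤ (ρ B) T-spans-q ⟩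
        ρ B + ρ T             ∎)))
      where open ≤-Reasoning

    X∩G₁≡∅⇒X⊆B : ∀ {X} → X ⊆ G → Empty (X ∩ G₁) → X ⊆ B
    X∩G₁≡∅⇒X⊆B X⊆G empty {x} x∈X with x ∈? B
    ... | yes x∈B = x∈B
    ... | no x∉B = ⊥-elim (empty (x , x∈p∩q⁺ (x∈X , x∈p∩q⁺ (X⊆G x∈X , x∉p⇒x∈∁p x∉B))))

    ¬badSplit-of-lift : ∀ {q U} → q ∈ A → ContractionConnected G₁ q → ¬ BadSplit G q U
    ¬badSplit-of-lift {q} {U} q∈A conn₁ bad@(U⊆ , _ , _ , ρ-small) = refute (nonempty? U₁) (nonempty? V₁)
      where
      nonLoop-q : NonLoop q
      nonLoop-q = nonLoop (A⊆G q∈A)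
      module S = Separation (badSplit⇒separation conn (A⊆G q∈A) nonLoop-q bad)
      q∈G₁ : q ∈ G₁
      q∈G₁ = A⊆G₁ q∈A
      V U₁ V₁ : Subset n
      V = offClass G q ∩ ∁ U
      U₁ = U ∩ G₁
      V₁ = offClass G₁ q ∩ ∁ U₁

      U₁⊆ : U₁ ⊆ offClass G₁ q
      U₁⊆ x∈U₁ = let x∈U , x∈G₁ = x∈p∩q⁻ U G₁ x∈U₁ in ∈offClass⁺ x∈G₁ (∈offClass⇒∦ (U⊆ x∈U))
      V₁⊆G₁ : V₁ ⊆ G₁
      V₁⊆G₁ = offClass⊆ ∘ p∩q⊆p _ _
      V₁⊆V : V₁ ⊆ V
      V₁⊆V x∈V₁ = let x∈off , x∉U₁ = x∈p∩q⁻ (offClass G₁ q) _ x∈V₁ in x∈p∩q⁺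
        ( ∈offClass⁺ (G₁⊆G (offClass⊆ x∈off)) (∈offClass⇒∦ x∈off)
        , x∉p⇒x∈∁p (λ x∈U → x∈∁p⇒x∉p x∉U₁ (x∈p∩q⁺ (x∈U , offClass⊆ x∈off))))
      V∩G₁⊆V₁ : V ∩ G₁ ⊆ V₁
      V∩G₁⊆V₁ x∈ = let x∈V , x∈G₁ = x∈p∩q⁻ V G₁ x∈ ; x∈off , x∉U = x∈p∩q⁻ (offClass G q) _ x∈V in x∈p∩q⁺
        ( ∈offClass⁺ x∈G₁ (∈offClass⇒∦ x∈off)
        , x∉p⇒x∈∁p (x∈∁p⇒x∉p x∉U ∘ p∩q⊆p U G₁))

      restrict-to-G₁ : ∀ {X X₁} → X₁ ⊆ X → X₁ ⊆ G₁ → ρ (X ∪ G₁) + ρ (⁅ q ⁆ ∪ X₁) ≤ ρ (⁅ q ⁆ ∪ X) + ρ G₁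
      restrict-to-G₁ {X} {X₁} X₁⊆X X₁⊆G₁ = submodular-⊆ (∪-monoʳ-⊆ ⁅ q ⁆ X₁⊆X)
        ([ x∈p⇒⁅x⁆⊆p q∈G₁ , X₁⊆G₁ ]′ ∘ x∈p∪q⁻ ⁅ q ⁆ X₁)
        ([ p⊆p∪q G₁ ∘ q⊆p∪q ⁅ q ⁆ X , q⊆p∪q _ G₁ ]′ ∘ x∈p∪q⁻ X G₁)

      ρG≤ρ[U∪V∪G₁] : ρ G ≤ ρ ((U ∪ G₁) ∪ (V ∪ G₁))
      ρG≤ρ[U∪V∪G₁] = class-spanned (p⊆p∪q _ (q⊆p∪q U G₁ q∈G₁)) nonLoop-q (⊆∪parallelClass λ w∈G q∦w →
        [ p⊆p∪q _ ∘ p⊆p∪q G₁ , q⊆p∪q _ _ ∘ p⊆p∪q G₁ ]′ (S.cover (∈offClass⁺ w∈G q∦w)))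

      -- Adding the six inequalities gives 2 + s ≤ 1 + s for their common sum s.
      too-small : ∀ a b t g g₁ u v u₁ v₁ → a + u₁ ≤ u + g₁ → b + v₁ ≤ v + g₁ → t + g₁ ≤ a + b → g ≤ t →
                  2 + g₁ ≤ u₁ + v₁ → u + v ≤ suc g → ⊥₀
      too-small a b t g g₁ u v u₁ v₁ h₁ h₂ h₃ h₄ h₅ h₆ = <-irrefl refl (begin
        2 + s                                      ≡⟨ sum-left a b t g g₁ u v u₁ v₁ ⟩
        (a + u₁) + (b + v₁) + (t + g₁) + g + (2 + g₁) + (u + v)
          ≤⟨ +-mono-≤ (+-mono-≤ (+-mono-≤ (+-mono-≤ (+-mono-≤ h₁ h₂) h₃) h₄) h₅) h₆ ⟩
        (u + g₁) + (v + g₁) + (a + b) + t + (u₁ + v₁) + suc g ≡⟨ sum-right a b t g g₁ u v u₁ v₁ ⟩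
        1 + s                                      ∎)
        where
        open ≤-Reasoning
        s : ℕ
        s = a + b + t + g + g₁ + g₁ + u + v + u₁ + v₁
        sum-left : ∀ a b t g g₁ u v u₁ v₁ → 2 + (a + b + t + g + g₁ + g₁ + u + v + u₁ + v₁) ≡
                   (a + u₁) + (b + v₁) + (t + g₁) + g + (2 + g₁) + (u + v)
        sum-left = solve-∀
        sum-right : ∀ a b t g g₁ u v u₁ v₁ → (u + g₁) + (v + g₁) + (a + b) + t + (u₁ + v₁) + suc g ≡
                    1 + (a + b + t + g + g₁ + g₁ + u + v + u₁ + v₁)
        sum-right = solve-∀

      refute : Dec (Nonempty U₁) → Dec (Nonempty V₁) → ⊥₀
      refute (no U₁≡∅) _ = q-not-spanned-in-B q∈A (X∩G₁≡∅⇒X⊆B (offClass⊆ ∘ U⊆) U₁≡∅) S.A-spans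
      refute (yes _) (no V₁≡∅) = q-not-spanned-in-B q∈A
        (X∩G₁≡∅⇒X⊆B (offClass⊆ ∘ p∩q⊆p _ _) λ (x , x∈) → V₁≡∅ (x , V∩G₁⊆V₁ x∈)) S.B-spans
      refute (yes U₁≠∅) (yes V₁≠∅) = too-small
        (ρ (U ∪ G₁)) (ρ (V ∪ G₁)) (ρ ((U ∪ G₁) ∪ (V ∪ G₁))) (ρ G) (ρ G₁)
        (ρ (⁅ q ⁆ ∪ U)) (ρ (⁅ q ⁆ ∪ V)) (ρ (⁅ q ⁆ ∪ U₁)) (ρ (⁅ q ⁆ ∪ V₁))
        (restrict-to-G₁ (p∩q⊆p U G₁) (p∩q⊆q U G₁))
        (restrict-to-G₁ V₁⊆V V₁⊆G₁)
        (submodular-⊆ (q⊆p∪q U G₁) (q⊆p∪q V G₁) ⊆-refl)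
        ρG≤ρ[U∪V∪G₁]
        (conn₁ U₁ U₁⊆ U₁≠∅ V₁≠∅)
        ρ-small

    contractionConnected-lift : ∀ {q} → q ∈ A → ContractionConnected G₁ q → ContractionConnected G q
    contractionConnected-lift q∈A conn₁ U U⊆ U≠∅ V≠∅ =
      ≮⇒≥ λ too-big → ¬badSplit-of-lift q∈A conn₁ (U⊆ , U≠∅ , V≠∅ , ≤-pred too-big)

    pair-lift : ContractiblePairAvoiding G₁ z → ContractiblePairIn G A
    pair-lift (q , r , q∈G₁ , r∈G₁ , conn-q , conn-r , z∦q , z∦r , q∦r) =
      q , r , q∈A , r∈A , contractionConnected-lift q∈A conn-q , contractionConnected-lift r∈A conn-r , q∦r
      where
      q∈A : q ∈ A
      q∈A = ∈G₁-off-z⇒∈A q∈G₁ z∦q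
      r∈A : r ∈ A
      r∈A = ∈G₁-off-z⇒∈A r∈G₁ z∦r

    pair-across : ∀ {p} → ContractibleAvoiding G p A → ContractibleAvoiding G p B → ContractiblePairAvoiding G p
    pair-across (q , q∈A , conn-q , p∦q) (r , r∈B , conn-r , p∦r) =
      q , r , A⊆G q∈A , B⊆G r∈B , conn-q , conn-r , p∦q , p∦r ,
      λ q∥r → ∈offClass⇒∦ (A⊆ q∈A) (B-spans-q⇒z∥q q∈A (parallel-spanned r∈B (nonLoop (B⊆G r∈B)) (parallel-sym q∥r)))

  avoid-class : ∀ {G S p} → NonLoop p → ContractiblePairIn G S → ContractibleAvoiding G p S
  avoid-class {p = p} nonLoop-p (q , r , q∈S , r∈S , conn-q , conn-r , q∦r) with Parallel? p q
  ... | no p∦q = q , q∈S , conn-q , p∦q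
  ... | yes p∥q = r , r∈S , conn-r , λ p∥r → q∦r (parallel-trans nonLoop-p (parallel-sym p∥q) p∥r)

  InductionHypothesis : Subset n → Set
  InductionHypothesis G = RankConnected G → 2 ≤ ρ G → ∀ {p} → p ∈ G → ContractiblePairAvoiding G p

  pair-from-badSplit : ∀ {G z p U} → (∀ {G′} → ∣ G′ ∣ < ∣ G ∣ → InductionHypothesis G′) →
    RankConnected G → 2 ≤ ρ G → z ∈ G → BadSplit G z U → p ∈ G → ContractiblePairAvoiding G p
  pair-from-badSplit {G} {z} {p} {U} IH conn 2≤ρG z∈G bad p∈G =
    pair-across (avoid-class nonLoop-p (side sep)) (avoid-class nonLoop-p (side (separation-swap sep)))
    where
    nonLoop-z : NonLoop z
    nonLoop-z = connected⇒nonLoop conn 2≤ρG z∈G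
    nonLoop-p : NonLoop p
    nonLoop-p = connected⇒nonLoop conn 2≤ρG p∈G
    sep : Separation G z U (offClass G z ∩ ∁ U)
    sep = badSplit⇒separation conn z∈G nonLoop-z bad
    open SeparationFacts conn z∈G nonLoop-z sep using (pair-across)
    side : ∀ {A B} → Separation G z A B → ContractiblePairIn G A
    side s = pair-lift (IH ∣G₁∣<∣G∣ connected-G₁ 2≤ρG₁ z∈G₁)
      where open SeparationFacts conn z∈G nonLoop-z s

  contractiblePairAvoiding : ∀ G → InductionHypothesis G
  contractiblePairAvoiding = All.wfRec (On.wellFounded ∣_∣ <-wellFounded) 0ℓ InductionHypothesis step
    where
    step : ∀ G → (∀ {G′} → ∣ G′ ∣ < ∣ G ∣ → InductionHypothesis G′) → InductionHypothesis G
    step G IH conn 2≤ρG {p} p∈G with ∃nonParallel conn 2≤ρG p∈G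
    ... | x , x∈G , p∦x with ∃nonParallelToBoth conn 2≤ρG p∈G x∈G p∦x
    ... | y , y∈G , p∦y , x∦y
      with badSplit⊎contractionConnected G p | badSplit⊎contractionConnected G x | badSplit⊎contractionConnected G y
    ... | inj₁ (_ , bad) | _ | _ = pair-from-badSplit IH conn 2≤ρG p∈G bad p∈G
    ... | inj₂ _ | inj₁ (_ , bad) | _ = pair-from-badSplit IH conn 2≤ρG x∈G bad p∈G
    ... | inj₂ _ | inj₂ _ | inj₁ (_ , bad) = pair-from-badSplit IH conn 2≤ρG y∈G bad p∈G
    ... | inj₂ _ | inj₂ conn-x | inj₂ conn-y = x , y , x∈G , y∈G , conn-x , conn-y , p∦x , p∦y , x∦y

  three-contractible : ∀ {G x} → RankConnected G → 2 ≤ ρ G → x ∈ G →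
    ∃ λ q₁ → ∃ λ q₂ → ∃ λ q₃ →
      ContractionConnected G q₁ × ContractionConnected G q₂ × ContractionConnected G q₃ ×
      ¬ Parallel q₁ q₂ × ¬ Parallel q₁ q₃ × ¬ Parallel q₂ q₃
  three-contractible {G} conn 2≤ρG x∈G with contractiblePairAvoiding G conn 2≤ρG x∈G
  ... | q₁ , q₂ , q₁∈G , q₂∈G , c₁ , c₂ , _ , _ , q₁∦q₂ with contractiblePairAvoiding G conn 2≤ρG q₁∈G
  ... | r₁ , r₂ , _ , _ , d₁ , d₂ , q₁∦r₁ , q₁∦r₂ , r₁∦r₂ with Parallel? q₂ r₁
  ... | no q₂∦r₁ = q₁ , q₂ , r₁ , c₁ , c₂ , d₁ , q₁∦q₂ , q₁∦r₁ , q₂∦r₁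
  ... | yes q₂∥r₁ = q₁ , q₂ , r₂ , c₁ , c₂ , d₂ , q₁∦q₂ , q₁∦r₂ ,
    λ q₂∥r₂ → r₁∦r₂ (parallel-trans (connected⇒nonLoop conn 2≤ρG q₂∈G) (parallel-sym q₂∥r₁) q₂∥r₂)

  ∦⇒2≤ρ⊤ : ∀ {x y} → ¬ Parallel x y → 2 ≤ ρ ⊤
  ∦⇒2≤ρ⊤ x∦y = ≤-trans (≰⇒> x∦y) (ρ-mono (λ _ → ∈⊤))

  ∦⇒parallelClass≢ : ∀ {x y} → ¬ Parallel x y → parallelClass x ≢ parallelClass y
  ∦⇒parallelClass≢ {x} {y} x∦y classes≡ = x∦y (∈parallelClass⁻ (subst (y ∈_) (sym classes≡) (q∈parallelClass y)))

module DualRank {n : ℕ} (M : Matroid n) where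
  open Matroid M
  open MatroidRank M
  open SubsetLemmas

  +-interchange : ∀ a b c d → (a + b) + (c + d) ≡ (a + c) + (b + d)
  +-interchange = interchange

  r⊤≤∣X∣+r∁X : ∀ X → r ⊤ ≤ ∣ X ∣ + r (∁ X)
  r⊤≤∣X∣+r∁X X = begin
    r ⊤                          ≤⟨ r-mono (⊆-reflexive (sym (p∪∁p≡⊤ X))) ⟩
    r (X ∪ ∁ X)                  ≤⟨ m≤m+n _ _ ⟩
    r (X ∪ ∁ X) + r (X ∩ ∁ X)    ≤⟨ r-submodular X (∁ X) ⟩
    r X + r (∁ X)                ≤⟨ +-monoˡ-≤ _ (r≤∣X∣ X) ⟩
    ∣ X ∣ + r (∁ X)              ∎
    where open ≤-Reasoning

  -- The rank function of the dual matroid; by r⊤≤∣X∣+r∁X the subtraction never truncates.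
  abstract
    r* : Subset n → ℕ
    r* X = ∣ X ∣ + r (∁ X) ∸ r ⊤

    r*-spec : ∀ X → r* X + r ⊤ ≡ ∣ X ∣ + r (∁ X)
    r*-spec X = m∸n+n≡m (r⊤≤∣X∣+r∁X X)

  r*-≤⁺ : ∀ {X Y} → ∣ X ∣ + r (∁ X) ≤ ∣ Y ∣ + r (∁ Y) → r* X ≤ r* Y
  r*-≤⁺ {X} {Y} le = +-cancelʳ-≤ (r ⊤) _ _ (subst₂ _≤_ (sym (r*-spec X)) (sym (r*-spec Y)) le)

  r*-mono : ∀ {X Y} → X ⊆ Y → r* X ≤ r* Y
  r*-mono {X} {Y} X⊆Y = r*-≤⁺ (begin
    ∣ X ∣ + r (∁ X)              ≤⟨ +-monoʳ-≤ ∣ X ∣ r∁X≤ ⟩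
    ∣ X ∣ + (∣ W ∣ + r (∁ Y))    ≡⟨ +-assoc ∣ X ∣ ∣ W ∣ _ ⟨
    ∣ X ∣ + ∣ W ∣ + r (∁ Y)      ≤⟨ +-monoˡ-≤ (r (∁ Y)) ∣X∣+∣W∣≤∣Y∣ ⟩
    ∣ Y ∣ + r (∁ Y)              ∎)
    where
    open ≤-Reasoning
    W : Subset n
    W = Y ∩ ∁ X
    ∁X⊆∁Y∪W : ∁ X ⊆ ∁ Y ∪ W
    ∁X⊆∁Y∪W {x} x∈∁X with x ∈? Y
    ... | yes x∈Y = q⊆p∪q (∁ Y) W (x∈p∩q⁺ (x∈Y , x∈∁X))
    ... | no x∉Y = p⊆p∪q W (x∉p⇒x∈∁p x∉Y)
    r∁X≤ : r (∁ X) ≤ ∣ W ∣ + r (∁ Y)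
    r∁X≤ = begin
      r (∁ X)                          ≤⟨ r-mono ∁X⊆∁Y∪W ⟩
      r (∁ Y ∪ W)                      ≤⟨ m≤m+n _ _ ⟩
      r (∁ Y ∪ W) + r (∁ Y ∩ W)        ≤⟨ r-submodular (∁ Y) W ⟩
      r (∁ Y) + r W                    ≤⟨ +-monoʳ-≤ (r (∁ Y)) (r≤∣X∣ W) ⟩
      r (∁ Y) + ∣ W ∣                  ≡⟨ +-comm (r (∁ Y)) ∣ W ∣ ⟩
      ∣ W ∣ + r (∁ Y)                  ∎
    ∣X∣+∣W∣≤∣Y∣ : ∣ X ∣ + ∣ W ∣ ≤ ∣ Y ∣
    ∣X∣+∣W∣≤∣Y∣ = begin
      ∣ X ∣ + ∣ W ∣  ≡⟨ disjoint⇒∣p∪q∣≡∣p∣+∣q∣ X W (λ x∈X x∈W → x∈∁p⇒x∉p (p∩q⊆q Y _ x∈W) x∈X) ⟨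
      ∣ X ∪ W ∣      ≤⟨ p⊆q⇒∣p∣≤∣q∣ ([ X⊆Y , p∩q⊆p Y _ ]′ ∘ x∈p∪q⁻ X W) ⟩
      ∣ Y ∣          ∎

  r*-submodular : ∀ X Y → r* (X ∪ Y) + r* (X ∩ Y) ≤ r* X + r* Y
  r*-submodular X Y = +-cancelʳ-≤ (t + t) _ _ (begin
    (r* X∪Y + r* X∩Y) + (t + t)                  ≡⟨ +-interchange (r* X∪Y) (r* X∩Y) t t ⟩
    (r* X∪Y + t) + (r* X∩Y + t)                  ≡⟨ cong₂ _+_ (r*-spec X∪Y) (r*-spec X∩Y) ⟩
    (∣ X∪Y ∣ + r (∁ X∪Y)) + (∣ X∩Y ∣ + r (∁ X∩Y)) ≡⟨ +-interchange (∣ X∪Y ∣) (r (∁ X∪Y)) (∣ X∩Y ∣) (r (∁ X∩Y)) ⟩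
    (∣ X∪Y ∣ + ∣ X∩Y ∣) + (r (∁ X∪Y) + r (∁ X∩Y))
      ≤⟨ +-mono-≤ (≤-reflexive (∣p∪q∣+∣p∩q∣≡∣p∣+∣q∣ X Y)) (+-mono-≤ (r-mono ∁∪⊆) (r-mono ∁∩⊆)) ⟩
    (∣ X ∣ + ∣ Y ∣) + (r (∁ X ∩ ∁ Y) + r (∁ X ∪ ∁ Y))
      ≤⟨ +-monoʳ-≤ (∣ X ∣ + ∣ Y ∣) (≤-trans (≤-reflexive (+-comm (r (∁ X ∩ ∁ Y)) (r (∁ X ∪ ∁ Y))))
                                           (r-submodular (∁ X) (∁ Y))) ⟩
    (∣ X ∣ + ∣ Y ∣) + (r (∁ X) + r (∁ Y))        ≡⟨ +-interchange (∣ X ∣) (∣ Y ∣) (r (∁ X)) (r (∁ Y)) ⟩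
    (∣ X ∣ + r (∁ X)) + (∣ Y ∣ + r (∁ Y))        ≡⟨ cong₂ _+_ (r*-spec X) (r*-spec Y) ⟨
    (r* X + t) + (r* Y + t)                      ≡⟨ +-interchange (r* X) t (r* Y) t ⟩
    (r* X + r* Y) + (t + t)                      ∎)
    where
    open ≤-Reasoning
    t : ℕ
    t = r ⊤
    X∪Y X∩Y : Subset n
    X∪Y = X ∪ Y
    X∩Y = X ∩ Y
    ∁∪⊆ : ∁ (X ∪ Y) ⊆ ∁ X ∩ ∁ Y
    ∁∪⊆ x∈ = x∈p∩q⁺ (x∉p⇒x∈∁p (x∈∁p⇒x∉p x∈ ∘ p⊆p∪q Y) , x∉p⇒x∈∁p (x∈∁p⇒x∉p x∈ ∘ q⊆p∪q X Y))
    ∁∩⊆ : ∁ (X ∩ Y) ⊆ ∁ X ∪ ∁ Y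
    ∁∩⊆ {x} x∈ with x ∈? X
    ... | no x∉X = p⊆p∪q _ (x∉p⇒x∈∁p x∉X)
    ... | yes x∈X = q⊆p∪q _ _ (x∉p⇒x∈∁p λ x∈Y → x∈∁p⇒x∉p x∈ (x∈p∩q⁺ (x∈X , x∈Y)))

  r*≤∣X∣ : ∀ X → r* X ≤ ∣ X ∣
  r*≤∣X∣ X = +-cancelʳ-≤ (r ⊤) _ _ (begin
    r* X + r ⊤          ≡⟨ r*-spec X ⟩
    ∣ X ∣ + r (∁ X)     ≤⟨ +-monoʳ-≤ ∣ X ∣ (r-mono (λ _ → ∈⊤)) ⟩
    ∣ X ∣ + r ⊤         ∎)
    where open ≤-Reasoning

  open SubmodularRank r* r*-mono r*-submodular r*≤∣X∣ public

  coIndep⇒∣X∣≤r* : ∀ {X} → CoIndep M X → ∣ X ∣ ≤ r* X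
  coIndep⇒∣X∣≤r* {X} (B , (indepB , maximal) , X⊆∁B) with extend-to-rank ⊤ B (λ _ → ∈⊤) indepB
  ... | J , B⊆J , _ , indepJ , ∣J∣≡r⊤ = +-cancelʳ-≤ (r ⊤) _ _ (begin
    ∣ X ∣ + r ⊤      ≤⟨ +-monoʳ-≤ ∣ X ∣ r⊤≤r∁X ⟩
    ∣ X ∣ + r (∁ X)  ≡⟨ r*-spec X ⟨
    r* X + r ⊤       ∎)
    where
    open ≤-Reasoning
    r⊤≤r∁X : r ⊤ ≤ r (∁ X)
    r⊤≤r∁X = ≤-trans (≤-reflexive (trans (sym ∣J∣≡r⊤) (cong ∣_∣ (maximal J B⊆J indepJ))))
                     (r-maximal (∁ X) B (λ x∈B → x∉p⇒x∈∁p λ x∈X → x∈∁p⇒x∉p (X⊆∁B x∈X) x∈B) indepB)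

  ∣X∣≤r*⇒coIndep : ∀ {X} → ∣ X ∣ ≤ r* X → CoIndep M X
  ∣X∣≤r*⇒coIndep {X} ∣X∣≤r* with r-attained (∁ X)
  ... | K , K⊆∁X , indepK , ∣K∣≡r =
    K , (indepK , λ I K⊆I indepI → sym (p⊆q∧∣q∣≤∣p∣⇒p≡q K⊆I (∣I∣≤∣K∣ I indepI))) ,
    λ x∈X → x∉p⇒x∈∁p λ x∈K → x∈∁p⇒x∉p (K⊆∁X x∈K) x∈X
    where
    r⊤≤r∁X : r ⊤ ≤ r (∁ X)
    r⊤≤r∁X = +-cancelˡ-≤ ∣ X ∣ _ _ (≤-trans (+-monoˡ-≤ (r ⊤) ∣X∣≤r*) (≤-reflexive (r*-spec X)))
    ∣I∣≤∣K∣ : ∀ I → Indep I → ∣ I ∣ ≤ ∣ K ∣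
    ∣I∣≤∣K∣ I indepI = ≤-trans (r-maximal ⊤ I (λ _ → ∈⊤) indepI) (≤-trans r⊤≤r∁X (≤-reflexive (sym ∣K∣≡r)))

  coIndep-⊆ : ∀ {D X} → D ⊆ X → CoIndep M X → CoIndep M D
  coIndep-⊆ D⊆X (B , base , X⊆∁B) = B , base , X⊆∁B ∘ D⊆X

  nonLoop⇒coIndep : ∀ {x} → NonLoop x → CoIndep M ⁅ x ⁆
  nonLoop⇒coIndep {x} nonLoop-x = ∣X∣≤r*⇒coIndep (≤-trans (≤-reflexive (∣⁅x⁆∣≡1 x)) nonLoop-x)

  D⊂⁅x⁆⇒Empty : ∀ {x} {D : Subset n} → D ⊂ ⁅ x ⁆ → Empty D
  D⊂⁅x⁆⇒Empty {x} {D} (D⊆⁅x⁆ , w , w∈⁅x⁆ , w∉D) (y , y∈D) =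
    w∉D (subst (_∈ D) (trans (x∈⁅y⁆⇒x≡y x (D⊆⁅x⁆ y∈D)) (sym (x∈⁅y⁆⇒x≡y x w∈⁅x⁆))) y∈D)

  coNonLoop⇒nonLoop : ∀ {x} → CoNonLoop M x → NonLoop x
  coNonLoop⇒nonLoop {x} coNonLoop-x = ≮⇒≥ λ r*⁅x⁆<1 → coNonLoop-x
    ( (λ coIndep → <⇒≱ r*⁅x⁆<1 (≤-trans (≤-reflexive (sym (∣⁅x⁆∣≡1 x))) (coIndep⇒∣X∣≤r* coIndep)))
    , λ D D⊂⁅x⁆ → ∣X∣≤r*⇒coIndep (≤-trans (≤-reflexive (Empty⇒∣p∣≡0 (D⊂⁅x⁆⇒Empty D⊂⁅x⁆))) z≤n))

  nonLoop⇒coNonLoop : ∀ {x} → NonLoop x → CoNonLoop M x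
  nonLoop⇒coNonLoop nonLoop-x (¬coIndep , _) = ¬coIndep (nonLoop⇒coIndep nonLoop-x)

  coParallel⇒parallel : ∀ {x y} → CoParallel M x y → Parallel x y
  coParallel⇒parallel {x} (inj₁ refl) = parallel-refl x
  coParallel⇒parallel {x} {y} (inj₂ (¬coIndep , _)) = ≮⇒≥ λ 1<r* → ¬coIndep (∣X∣≤r*⇒coIndep (begin
    ∣ ⁅ x ⁆ ∪ ⁅ y ⁆ ∣        ≤⟨ ∣p∪q∣≤∣p∣+∣q∣ ⁅ x ⁆ ⁅ y ⁆ ⟩
    ∣ ⁅ x ⁆ ∣ + ∣ ⁅ y ⁆ ∣    ≡⟨ cong₂ _+_ (∣⁅x⁆∣≡1 x) (∣⁅x⁆∣≡1 y) ⟩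
    2                        ≤⟨ 1<r* ⟩
    r* (⁅ x ⁆ ∪ ⁅ y ⁆)       ∎))
    where open ≤-Reasoning

  parallel⇒coParallel : ∀ {x y} → NonLoop x → NonLoop y → Parallel x y → CoParallel M x y
  parallel⇒coParallel {x} {y} nonLoop-x nonLoop-y x∥y with x ≟ᶠ y
  ... | yes x≡y = inj₁ x≡y
  ... | no x≢y = inj₂ (¬coIndep , proper-coIndep)
    where
    ∣xy∣≡2 : ∣ ⁅ x ⁆ ∪ ⁅ y ⁆ ∣ ≡ 2
    ∣xy∣≡2 = trans (disjoint⇒∣p∪q∣≡∣p∣+∣q∣ ⁅ x ⁆ ⁅ y ⁆ λ w∈⁅x⁆ w∈⁅y⁆ → x≢y (trans (sym (x∈⁅y⁆⇒x≡y x w∈⁅x⁆)) (x∈⁅y⁆⇒x≡y y w∈⁅y⁆)))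
                   (cong₂ _+_ (∣⁅x⁆∣≡1 x) (∣⁅x⁆∣≡1 y))
    ¬coIndep : ¬ CoIndep M (⁅ x ⁆ ∪ ⁅ y ⁆)
    ¬coIndep coIndep = <⇒≱ (s≤s x∥y) (≤-trans (≤-reflexive (sym ∣xy∣≡2)) (coIndep⇒∣X∣≤r* coIndep))
    proper-coIndep : ∀ D → D ⊂ ⁅ x ⁆ ∪ ⁅ y ⁆ → CoIndep M D
    proper-coIndep D (D⊆ , w , w∈ , w∉D) with x∈p∪q⁻ ⁅ x ⁆ ⁅ y ⁆ w∈
    ... | inj₁ w∈⁅x⁆ = coIndep-⊆ (⊆⁅x⁆∪q∧x∉⇒⊆q D⊆ (w∉D ∘ subst (_∈ D) (sym (x∈⁅y⁆⇒x≡y x w∈⁅x⁆))))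
                                 (nonLoop⇒coIndep nonLoop-y)
    ... | inj₂ w∈⁅y⁆ = coIndep-⊆ (⊆⁅x⁆∪q∧x∉⇒⊆q (∪-comm-⊆ ∘ D⊆) (w∉D ∘ subst (_∈ D) (sym (x∈⁅y⁆⇒x≡y y w∈⁅y⁆))))
                                 (nonLoop⇒coIndep nonLoop-x)
      where
      ∪-comm-⊆ : ⁅ x ⁆ ∪ ⁅ y ⁆ ⊆ ⁅ y ⁆ ∪ ⁅ x ⁆
      ∪-comm-⊆ = [ q⊆p∪q ⁅ y ⁆ ⁅ x ⁆ , p⊆p∪q ⁅ x ⁆ ]′ ∘ x∈p∪q⁻ ⁅ x ⁆ ⁅ y ⁆

  separates⇒r-additive : ∀ {E X} → SeparatesOn M E X → r X + r (E ∩ ∁ X) ≤ r E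
  separates⇒r-additive {E} {X} (X⊆E , _ , _ , splits) with r-attained X | r-attained (E ∩ ∁ X)
  ... | I₁ , I₁⊆X , indepI₁ , ∣I₁∣≡rX | I₂ , I₂⊆Y , indepI₂ , ∣I₂∣≡rY = begin
    r X + r Y          ≡⟨ cong₂ _+_ ∣I₁∣≡rX ∣I₂∣≡rY ⟨
    ∣ I₁ ∣ + ∣ I₂ ∣    ≡⟨ disjoint⇒∣p∪q∣≡∣p∣+∣q∣ I₁ I₂ (λ x∈I₁ x∈I₂ → ∉X (I₂⊆Y x∈I₂) (I₁⊆X x∈I₁)) ⟨
    ∣ I₁ ∪ I₂ ∣        ≤⟨ r-maximal E (I₁ ∪ I₂) I⊆E (proj₂ (splits (I₁ ∪ I₂) I⊆E) (indep-sub I∩X⊆I₁ indepI₁ , indep-sub I∩Y⊆I₂ indepI₂)) ⟩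
    r E                ∎
    where
    open ≤-Reasoning
    Y : Subset n
    Y = E ∩ ∁ X
    ∉X : ∀ {x} → x ∈ Y → x ∉ X
    ∉X = x∈∁p⇒x∉p ∘ p∩q⊆q E _
    I⊆E : I₁ ∪ I₂ ⊆ E
    I⊆E = [ X⊆E ∘ I₁⊆X , p∩q⊆p E _ ∘ I₂⊆Y ]′ ∘ x∈p∪q⁻ I₁ I₂
    I∩X⊆I₁ : (I₁ ∪ I₂) ∩ X ⊆ I₁
    I∩X⊆I₁ x∈ with x∈p∩q⁻ (I₁ ∪ I₂) X x∈
    ... | x∈I , x∈X = [ id , (λ x∈I₂ → ⊥-elim (∉X (I₂⊆Y x∈I₂) x∈X)) ]′ (x∈p∪q⁻ I₁ I₂ x∈I)
    I∩Y⊆I₂ : (I₁ ∪ I₂) ∩ Y ⊆ I₂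
    I∩Y⊆I₂ x∈ with x∈p∩q⁻ (I₁ ∪ I₂) Y x∈
    ... | x∈I , x∈Y = [ (λ x∈I₁ → ⊥-elim (∉X x∈Y (I₁⊆X x∈I₁))) , id ]′ (x∈p∪q⁻ I₁ I₂ x∈I)

  r-additive⇒separates : ∀ {E X} → X ⊆ E → Nonempty X → Nonempty (E ∩ ∁ X) →
                         r X + r (E ∩ ∁ X) ≤ r E → SeparatesOn M E X
  r-additive⇒separates {E} {X} X⊆E X≠∅ Y≠∅ additive = X⊆E , X≠∅ , Y≠∅ , λ I I⊆E →
    (λ indepI → indep-sub (p∩q⊆p I X) indepI , indep-sub (p∩q⊆p I Y) indepI) ,
    λ (indepI∩X , indepI∩Y) → ∣I∣≤r⇒Indep (begin
      ∣ I ∣                        ≤⟨ p⊆q⇒∣p∣≤∣q∣ (I⊆ I⊆E) ⟩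
      ∣ (I ∩ X) ∪ (I ∩ Y) ∣        ≤⟨ ∣p∪q∣≤∣p∣+∣q∣ (I ∩ X) (I ∩ Y) ⟩
      ∣ I ∩ X ∣ + ∣ I ∩ Y ∣        ≤⟨ +-mono-≤ (Indep⇒∣I∣≤r indepI∩X) (Indep⇒∣I∣≤r indepI∩Y) ⟩
      r (I ∩ X) + r (I ∩ Y)        ≤⟨ parts-bounded I I⊆E ⟩
      r I                          ∎)
    where
    open ≤-Reasoning
    open SubmodularRank r r-mono r-submodular r≤∣X∣ using () renaming (submodular-⊆ to r-submodular-⊆)
    Y : Subset n
    Y = E ∩ ∁ X
    I⊆ : ∀ {I} → I ⊆ E → I ⊆ (I ∩ X) ∪ (I ∩ Y)
    I⊆ I⊆E {x} x∈I with x ∈? X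
    ... | yes x∈X = p⊆p∪q _ (x∈p∩q⁺ (x∈I , x∈X))
    ... | no x∉X = q⊆p∪q _ _ (x∈p∩q⁺ (x∈I , x∈p∩q⁺ (I⊆E x∈I , x∉p⇒x∈∁p x∉X)))
    -- Submodularity twice, through the set (I ∩ X) ∪ Y.
    parts-bounded : ∀ I → I ⊆ E → r (I ∩ X) + r (I ∩ Y) ≤ r I
    parts-bounded I I⊆E = +-cancelʳ-≤ (r E + c) _ _ (begin
      (i₁ + i₂) + (r E + c)     ≡⟨ shuffle₁ i₁ i₂ (r E) c ⟩
      (r E + i₁) + (c + i₂)     ≤⟨ +-mono-≤ via-X via-I ⟩
      (r X + c) + (r I + r Y)   ≡⟨ shuffle₂ (r X) c (r I) (r Y) ⟩
      (r X + r Y) + (r I + c)   ≤⟨ +-monoˡ-≤ (r I + c) additive ⟩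
      r E + (r I + c)           ≡⟨ shuffle₃ (r E) (r I) c ⟩
      r I + (r E + c)           ∎)
      where
      i₁ i₂ c : ℕ
      i₁ = r (I ∩ X)
      i₂ = r (I ∩ Y)
      c = r ((I ∩ X) ∪ Y)
      via-X : r E + i₁ ≤ r X + c
      via-X = r-submodular-⊆ (p∩q⊆q I X) (p⊆p∪q Y) ([ p⊆p∪q _ , q⊆p∪q X _ ∘ q⊆p∪q (I ∩ X) Y ]′ ∘ x∈p∪q⁻ X Y ∘ E⊆X∪[E∩∁X] E X)
      via-I : c + i₂ ≤ r I + r Y
      via-I = r-submodular-⊆ (p∩q⊆p I Y) (p∩q⊆q I Y) ([ p⊆p∪q Y ∘ p∩q⊆p I X , q⊆p∪q I Y ]′ ∘ x∈p∪q⁻ (I ∩ X) Y)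
      shuffle₁ : ∀ a b e c → (a + b) + (e + c) ≡ (e + a) + (c + b)
      shuffle₁ = solve-∀
      shuffle₂ : ∀ x c i y → (x + c) + (i + y) ≡ (x + y) + (i + c)
      shuffle₂ = solve-∀
      shuffle₃ : ∀ e i c → e + (i + c) ≡ i + (e + c)
      shuffle₃ = solve-∀

  connected⇒r-connected : ∀ {E X} → ConnectedOn M E → X ⊆ E → Nonempty X → Nonempty (E ∩ ∁ X) →
                          suc (r E) ≤ r X + r (E ∩ ∁ X)
  connected⇒r-connected {E} {X} connected X⊆E X≠∅ Y≠∅ =
    ≮⇒≥ λ small → connected X (r-additive⇒separates X⊆E X≠∅ Y≠∅ (≤-pred small))

  r*⊤+r⊤≡n : r* ⊤ + r ⊤ ≡ n
  r*⊤+r⊤≡n = begin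
    r* ⊤ + r ⊤             ≡⟨ r*-spec ⊤ ⟩
    ∣ ⊤ {n} ∣ + r (∁ ⊤)    ≡⟨ cong₂ _+_ (∣⊤∣≡n n) (n≤0⇒n≡0 (≤-trans (r≤∣X∣ (∁ ⊤)) (≤-reflexive (Empty⇒∣p∣≡0 (∁⊤-empty {n}))))) ⟩
    n + 0                  ≡⟨ +-identityʳ n ⟩
    n                      ∎
    where open ≡-Reasoning

  connected⇒r*-connected : Connected M → RankConnected ⊤
  connected⇒r*-connected connected A A⊆⊤ A≠∅ B≠∅ = +-cancelʳ-≤ (t + t) _ _ (begin
    suc (r* ⊤) + (t + t)                        ≡⟨ shuffle (r* ⊤) t ⟩
    (r* ⊤ + t) + suc t                          ≤⟨ +-mono-≤ (≤-reflexive r*⊤+r⊤≡n) (connected⇒r-connected connected A⊆⊤ A≠∅ B≠∅) ⟩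
    n + (r A + r B)                             ≤⟨ +-mono-≤ n≤∣A∣+∣B∣ (+-mono-≤ (r-mono A⊆∁B) (r-mono B⊆∁A)) ⟩
    (∣ A ∣ + ∣ B ∣) + (r (∁ B) + r (∁ A))       ≡⟨ cong (∣ A ∣ + ∣ B ∣ +_) (+-comm (r (∁ B)) (r (∁ A))) ⟩
    (∣ A ∣ + ∣ B ∣) + (r (∁ A) + r (∁ B))       ≡⟨ +-interchange (∣ A ∣) (∣ B ∣) (r (∁ A)) (r (∁ B)) ⟩
    (∣ A ∣ + r (∁ A)) + (∣ B ∣ + r (∁ B))       ≡⟨ cong₂ _+_ (r*-spec A) (r*-spec B) ⟨
    (r* A + t) + (r* B + t)                     ≡⟨ +-interchange (r* A) t (r* B) t ⟩
    (r* A + r* B) + (t + t)                     ∎)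
    where
    open ≤-Reasoning
    t : ℕ
    t = r ⊤
    B : Subset n
    B = ⊤ ∩ ∁ A
    A⊆∁B : A ⊆ ∁ B
    A⊆∁B x∈A = x∉p⇒x∈∁p λ x∈B → x∈∁p⇒x∉p (p∩q⊆q ⊤ _ x∈B) x∈A
    B⊆∁A : B ⊆ ∁ A
    B⊆∁A = p∩q⊆q ⊤ _
    n≤∣A∣+∣B∣ : n ≤ ∣ A ∣ + ∣ B ∣
    n≤∣A∣+∣B∣ = ≤-trans (≤-reflexive (sym (∣⊤∣≡n n)))
                  (≤-trans (p⊆q⇒∣p∣≤∣q∣ (E⊆X∪[E∩∁X] ⊤ A)) (∣p∪q∣≤∣p∣+∣q∣ A B))
    shuffle : ∀ a t → suc a + (t + t) ≡ (a + t) + suc t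
    shuffle = solve-∀

  parallelClass-series : ∀ {q} → (∀ x → NonLoop x) → SeriesClass M (parallelClass q)
  parallelClass-series {q} nonLoop = q , nonLoop⇒coNonLoop (nonLoop q) , λ f →
    (λ f∈S → nonLoop⇒coNonLoop (nonLoop f) , parallel⇒coParallel (nonLoop q) (nonLoop f) (∈parallelClass⁻ f∈S)) ,
    (λ (_ , q∥f) → ∈parallelClass⁺ (coParallel⇒parallel q∥f))

  -- A separation X | Y of M − S, with S the class of q, would give the bad split X | Y of the
  -- contraction by q in the dual, because the connectivity function is self-dual.
  contractionConnected⇒deletionConnected : ∀ {q} → NonLoop q → ContractionConnected ⊤ q →
                                           DeletionConnected M (parallelClass q)
  contractionConnected⇒deletionConnected {q} nonLoop-q conn-q X (X⊆∁S , X≠∅ , (y , y∈Y) , splits) =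
    too-small (r* ⊤) (r ⊤) (r* (⁅ q ⁆ ∪ X)) (r* (⁅ q ⁆ ∪ V)) (∣ S ∣) (∣ X ∣) (∣ V ∣) (r X) (r Y) (r (∁ S)) (r* S)
      (conn-q X X⊆off X≠∅ (y , Y⊆V y∈Y))
      (r*[q∪Z]+r⊤≤ X Y ∁[S∪X]⊆Y)
      (r*[q∪Z]+r⊤≤ V X ∁[S∪V]⊆X)
      ∣S∣+∣X∣+∣V∣≤r*⊤+r⊤
      (separates⇒r-additive (X⊆∁S , X≠∅ , (y , y∈Y) , splits))
      (r*-spec S)
      (ρ≤1-inside-class nonLoop-q ⊆-refl)
    where
    S Y V : Subset n
    S = parallelClass q
    Y = ∁ S ∩ ∁ X
    V = offClass ⊤ q ∩ ∁ X
    ∉S⇒∈off : ∀ {x} → x ∉ S → x ∈ offClass ⊤ q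
    ∉S⇒∈off x∉S = ∈offClass⁺ ∈⊤ (x∉S ∘ ∈parallelClass⁺)
    X⊆off : X ⊆ offClass ⊤ q
    X⊆off = ∉S⇒∈off ∘ x∈∁p⇒x∉p ∘ X⊆∁S
    Y⊆V : Y ⊆ V
    Y⊆V x∈Y = let x∈∁S , x∈∁X = x∈p∩q⁻ (∁ S) (∁ X) x∈Y in x∈p∩q⁺ (∉S⇒∈off (x∈∁p⇒x∉p x∈∁S) , x∈∁X)
    ∁[S∪X]⊆Y : ∁ (S ∪ X) ⊆ Y
    ∁[S∪X]⊆Y x∈ = x∈p∩q⁺ (x∉p⇒x∈∁p (x∈∁p⇒x∉p x∈ ∘ p⊆p∪q X) , x∉p⇒x∈∁p (x∈∁p⇒x∉p x∈ ∘ q⊆p∪q S X))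
    ∁[S∪V]⊆X : ∁ (S ∪ V) ⊆ X
    ∁[S∪V]⊆X {x} x∈ with x ∈? X
    ... | yes x∈X = x∈X
    ... | no x∉X = ⊥-elim (x∈∁p⇒x∉p x∈ (q⊆p∪q S V (x∈p∩q⁺ (∉S⇒∈off (x∈∁p⇒x∉p x∈ ∘ p⊆p∪q V) , x∉p⇒x∈∁p x∉X))))
    r*[q∪Z]+r⊤≤ : ∀ Z W → ∁ (S ∪ Z) ⊆ W → r* (⁅ q ⁆ ∪ Z) + r ⊤ ≤ ∣ S ∣ + ∣ Z ∣ + r W
    r*[q∪Z]+r⊤≤ Z W ∁⊆W = begin
      r* (⁅ q ⁆ ∪ Z) + r ⊤       ≤⟨ +-monoˡ-≤ (r ⊤) (r*-mono (∪-monoˡ-⊆ (x∈p⇒⁅x⁆⊆p (q∈parallelClass q)))) ⟩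
      r* (S ∪ Z) + r ⊤           ≡⟨ r*-spec (S ∪ Z) ⟩
      ∣ S ∪ Z ∣ + r (∁ (S ∪ Z))  ≤⟨ +-mono-≤ (∣p∪q∣≤∣p∣+∣q∣ S Z) (r-mono ∁⊆W) ⟩
      ∣ S ∣ + ∣ Z ∣ + r W        ∎
      where open ≤-Reasoning
    ∣S∣+∣X∣+∣V∣≤r*⊤+r⊤ : ∣ S ∣ + ∣ X ∣ + ∣ V ∣ ≤ r* ⊤ + r ⊤
    ∣S∣+∣X∣+∣V∣≤r*⊤+r⊤ = begin
      ∣ S ∣ + ∣ X ∣ + ∣ V ∣      ≡⟨ +-assoc (∣ S ∣) (∣ X ∣) (∣ V ∣) ⟩
      ∣ S ∣ + (∣ X ∣ + ∣ V ∣)    ≡⟨ cong (∣ S ∣ +_) (disjoint⇒∣p∪q∣≡∣p∣+∣q∣ X V λ x∈X x∈V → x∈∁p⇒x∉p (p∩q⊆q _ _ x∈V) x∈X) ⟨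
      ∣ S ∣ + ∣ X ∪ V ∣          ≡⟨ disjoint⇒∣p∪q∣≡∣p∣+∣q∣ S (X ∪ V) S∩[X∪V]≡∅ ⟨
      ∣ S ∪ (X ∪ V) ∣            ≤⟨ ∣p∣≤n (S ∪ (X ∪ V)) ⟩
      n                          ≡⟨ r*⊤+r⊤≡n ⟨
      r* ⊤ + r ⊤                 ∎
      where
      open ≤-Reasoning
      S∩[X∪V]≡∅ : ∀ {x} → x ∈ S → x ∉ X ∪ V
      S∩[X∪V]≡∅ x∈S x∈X∪V = [ (λ x∈X → ∈offClass⇒∦ (X⊆off x∈X) (∈parallelClass⁻ x∈S))
                            , (λ x∈V → ∈offClass⇒∦ (p∩q⊆p _ _ x∈V) (∈parallelClass⁻ x∈S)) ]′ (x∈p∪q⁻ X V x∈X∪V)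
    -- Adding the hypotheses gives 2 + s ≤ 1 + s for their common sum s.
    too-small : ∀ P T a b s x v rX rY rS ρS → 2 + P ≤ a + b → a + T ≤ s + x + rY → b + T ≤ s + v + rX →
                s + x + v ≤ P + T → rX + rY ≤ rS → ρS + T ≡ s + rS → ρS ≤ 1 → ⊥₀
    too-small P T a b s x v rX rY rS ρS h₁ h₂ h₃ h₄ h₅ h₆ h₇ = <-irrefl refl (begin
      2 + c                                                          ≡⟨ sum-left P T a b s x v rX rY rS ρS ⟩
      (2 + P) + (a + T) + (b + T) + (s + x + v) + (rX + rY) + (s + rS) + ρS
        ≤⟨ +-mono-≤ (+-mono-≤ (+-mono-≤ (+-mono-≤ (+-mono-≤ (+-mono-≤ h₁ h₂) h₃) h₄) h₅) (≤-reflexive (sym h₆))) h₇ ⟩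
      (a + b) + (s + x + rY) + (s + v + rX) + (P + T) + rS + (ρS + T) + 1 ≡⟨ sum-right P T a b s x v rX rY rS ρS ⟩
      1 + c                                                          ∎)
      where
      open ≤-Reasoning
      c : ℕ
      c = P + T + T + a + b + s + s + x + v + rX + rY + rS + ρS
      sum-left : ∀ P T a b s x v rX rY rS ρS → 2 + (P + T + T + a + b + s + s + x + v + rX + rY + rS + ρS) ≡
                 (2 + P) + (a + T) + (b + T) + (s + x + v) + (rX + rY) + (s + rS) + ρS
      sum-left = solve-∀
      sum-right : ∀ P T a b s x v rX rY rS ρS → (a + b) + (s + x + rY) + (s + v + rX) + (P + T) + rS + (ρS + T) + 1 ≡
                  1 + (P + T + T + a + b + s + s + x + v + rX + rY + rS + ρS)
      sum-right = solve-∀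

  contractionConnected⇒regular : ∀ {q} → RankConnected ⊤ → 2 ≤ r* ⊤ → ContractionConnected ⊤ q →
                                 RegularSeriesClass M (parallelClass q)
  contractionConnected⇒regular {q} conn 2≤r*⊤ conn-q =
    parallelClass-series nonLoop , contractionConnected⇒deletionConnected (nonLoop q) conn-q
    where
    nonLoop : ∀ x → NonLoop x
    nonLoop x = connected⇒nonLoop conn 2≤r*⊤ ∈⊤

  parallel-representatives⇒⊆ : ∀ {S T} (σ : SeriesClass M S) (τ : SeriesClass M T) →
                               Parallel (proj₁ σ) (proj₁ τ) → S ⊆ T
  parallel-representatives⇒⊆ (e , coNonLoop-e , S-spec) (e′ , coNonLoop-e′ , T-spec) e∥e′ {f} f∈S =
    let coNonLoop-f , e≈f = proj₁ (S-spec f) f∈S in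
    proj₂ (T-spec f) (coNonLoop-f , parallel⇒coParallel (coNonLoop⇒nonLoop coNonLoop-e′) (coNonLoop⇒nonLoop coNonLoop-f)
      (parallel-trans (coNonLoop⇒nonLoop coNonLoop-e) (parallel-sym e∥e′) (coParallel⇒parallel e≈f)))

  distinct-series⇒∦ : ∀ {S T} (σ : SeriesClass M S) (τ : SeriesClass M T) → S ≢ T →
                      ¬ Parallel (proj₁ σ) (proj₁ τ)
  distinct-series⇒∦ σ τ S≢T e∥e′ =
    S≢T (⊆-antisym (parallel-representatives⇒⊆ σ τ e∥e′) (parallel-representatives⇒⊆ τ σ (parallel-sym e∥e′)))

  three-regular : RankConnected ⊤ → 2 ≤ r* ⊤ → Fin n →
    ∃ λ S₁ → ∃ λ S₂ → ∃ λ S₃ →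
      RegularSeriesClass M S₁ × RegularSeriesClass M S₂ × RegularSeriesClass M S₃ ×
      S₁ ≢ S₂ × S₁ ≢ S₃ × S₂ ≢ S₃
  three-regular conn 2≤r*⊤ x =
    let q₁ , q₂ , q₃ , c₁ , c₂ , c₃ , q₁∦q₂ , q₁∦q₃ , q₂∦q₃ = three-contractible conn 2≤r*⊤ (∈⊤ {x = x}) in
    parallelClass q₁ , parallelClass q₂ , parallelClass q₃ ,
    regular {q₁} c₁ , regular {q₂} c₂ , regular {q₃} c₃ ,
    ∦⇒parallelClass≢ {q₁} {q₂} q₁∦q₂ , ∦⇒parallelClass≢ {q₁} {q₃} q₁∦q₃ , ∦⇒parallelClass≢ {q₂} {q₃} q₂∦q₃
    where
    regular : ∀ {q} → ContractionConnected ⊤ q → RegularSeriesClass M (parallelClass q)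
    regular = contractionConnected⇒regular conn 2≤r*⊤

mainTheorem4 : ∀ {n : ℕ} (M : Matroid n) → Connected M →
    (∃ λ S → ∃ λ T → SeriesClass M S × SeriesClass M T × S ≢ T) →
    ∃ λ S₁ → ∃ λ S₂ → ∃ λ S₃ →
      RegularSeriesClass M S₁ × RegularSeriesClass M S₂ × RegularSeriesClass M S₃ ×
      S₁ ≢ S₂ × S₁ ≢ S₃ × S₂ ≢ S₃
mainTheorem4 M connected (_ , _ , σ , τ , S≢T) =
  three-regular (connected⇒r*-connected connected) (∦⇒2≤ρ⊤ (distinct-series⇒∦ σ τ S≢T)) (proj₁ σ)
  where open DualRank M
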